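{- Let $n\ge 2$, $1\le t\le n-1$, $N=2^n-1$, $T=2^t-1$, $M=2^{n-t}-1$. Let $C$ be the binary code of length $N$ with parity check matrix $H_{n,t}$, let $\mathcal{D}$ be the triple system on $V=\{1,\dots,N\}$ whose blocks are the supports of all weight-$3$ codewords of $C$, let $V_0$ be the set of indices of zero columns of $H_{n,t}$, and for each nonzero $u\in\mathrm{GF}(2)^{n-t}$ let $G_u$ be the set of indices whose column equals $u$. Let $\mathcal{S}$ be any Steiner triple system on $V$ all of whose blocks are blocks of $\mathcal{D}$, with block set $\mathcal{B}$. Then $\mathcal{B}$ is the disjoint union of: (1) a set $\mathcal{B}_0$ of $T(T-1)/6$ blocks contained in $V_0$ such that $(V_0,\mathcal{B}_0)$ is a Steiner triple system on $V_0$; (2) for each nonzero $u$, a set $\mathcal{B}_u$ of $T(T+1)/2$ blocks each of the form $\{x,y,y'\}$ with $x\in V_0$ and $y,y'\in G_u$; for each $x\in V_0$ there are exactly $(T+1)/2=2^{t-1}$ such blocks containing $x$, the pairs $\{y,y'\}$ occurring in them form a $1$-factor $F^{(u)}_x$ of the complete graph on $G_u$, and the $1$-factors $F^{(u)}_x$ ($x\in V_0$) form a $1$-factorization of this complete graph; (3) for each line $\ell=\{a,b,a+b\}$ of $PG(n-1-t,2)$, a set $\mathcal{B}_\ell$ of $(T+1)^2=2^{2t}$ blocks forming a transversal design $TD[3;T+1]$ on the three groups $G_a,G_b,G_{a+b}$.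
   Context: $H_{n,t}$ is the $(n-t)\times(2^n-1)$ binary matrix obtained from the matrix $H_n$ (whose columns are all distinct nonzero vectors of $\mathrm{GF}(2)^n$) by deleting $t$ rows; its columns consist of every nonzero vector of $\mathrm{GF}(2)^{n-t}$ exactly $2^t$ times and the zero vector exactly $2^t-1$ times. $C=\{c\in\mathrm{GF}(2)^N:H_{n,t}c^T=0\}$. A Steiner triple system on $V$ is a set of $3$-subsets (blocks) such that every $2$-subset of $V$ lies in exactly one block. The points of $PG(n-1-t,2)$ are the nonzero vectors of $\mathrm{GF}(2)^{n-t}$ and its lines are the triples $\{a,b,a+b\}$ with $a\ne b$ nonzero. A transversal design $TD[3;g]$ on three disjoint groups of size $g$ is a set of $3$-subsets each meeting every group in one point such that any two points from different groups lie in exactly one of them. -}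

module Defs where

open import Data.Bool using (Bool; true; false; _xor_; if_then_else_)
import Data.Bool as Bool
open import Data.Nat using (ℕ; zero; suc; _+_; _*_; _∸_; _^_; _/_)
import Data.Nat as Nat
open import Data.Fin using (Fin)
import Data.Fin as Fin
open import Data.Fin.Properties using (all?)
open import Data.Fin.Subset using (Subset; _∈_; _∉_; _⊆_; ∣_∣; _∩_; _─_; ⁅_⁆)
open import Data.Fin.Subset.Properties using (_∈?_)
open import Data.Vec using (Vec; []; _∷_; replicate; zipWith; tabulate; lookup)
open import Data.Vec.Properties using (≡-dec)
open import Data.List using (List; length; filter; map; allFin)
open import Data.List.Relation.Unary.All using (All)
open import Data.List.Relation.Unary.Unique.Propositional using (Unique)
open import Data.Product using (Σ; _×_; _,_; ∃)
open import Data.Sum using (_⊎_)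
open import Function using (_∘_)
open import Relation.Nullary using (Dec; ¬_; does)
open import Relation.Nullary.Decidable using (_×-dec_; _→-dec_; map′)
open import Relation.Unary using (Decidable)
open import Relation.Binary.PropositionalEquality using (_≡_; _≢_)

GF2 : ℕ → Set
GF2 k = Vec Bool k

0v : ∀ {k} → GF2 k
0v = replicate _ false

_⊕_ : ∀ {k} → GF2 k → GF2 k → GF2 k
_⊕_ = zipWith _xor_

Nonzero : ∀ {k} → GF2 k → Set
Nonzero v = v ≢ 0v

_≟v_ : ∀ {k} (u v : GF2 k) → Dec (u ≡ v)
_≟v_ = ≡-dec Bool._≟_

-- The matrix H_{n,t}.
-- `e` lists the columns of H_n (e i = i-th column, a vector of GF(2)^n);
-- `keep` lists (in increasing order) the n-t rows that are NOT deleted.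

Hnt : ∀ {N n k} → (Fin N → GF2 n) → (Fin k → Fin n) → Fin N → GF2 k
Hnt e keep i = tabulate (λ j → lookup (e i) (keep j))

-- The code C with parity check matrix given by its columns `col`.
-- A binary word c ∈ GF(2)^N is identified with its support (Subset N is
-- literally Vec Bool N).

syndrome : ∀ {N m} → (Fin N → GF2 m) → Vec Bool N → GF2 m
syndrome {zero}  col []      = 0v
syndrome {suc N} col (b ∷ c) =
  (if b then col Fin.zero else 0v) ⊕ syndrome (col ∘ Fin.suc) c

IsCodeword : ∀ {N m} → (Fin N → GF2 m) → Vec Bool N → Set
IsCodeword col c = syndrome col c ≡ 0v

IsDBlock : ∀ {N m} → (Fin N → GF2 m) → Subset N → Set
IsDBlock col s = IsCodeword col s × ∣ s ∣ ≡ 3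

V0 : ∀ {N m} → (Fin N → GF2 m) → Subset N
V0 col = tabulate (λ i → does (col i ≟v 0v))

G : ∀ {N m} → (Fin N → GF2 m) → GF2 m → Subset N
G col u = tabulate (λ i → does (col i ≟v u))

-- Generic helpers (sets of blocks are duplicate-free lists)

count : ∀ {a p} {A : Set a} {P : A → Set p} → Decidable P → List A → ℕ
count P? xs = length (filter P? xs)

_⊆?_ : ∀ {N} (p q : Subset N) → Dec (p ⊆ q)
p ⊆? q = map′ (λ f {x} → f x) (λ f x → f)
              (all? (λ x → (x ∈? p) →-dec (x ∈? q)))

_≟s_ : ∀ {N} (p q : Subset N) → Dec (p ≡ q)
_≟s_ = ≡-dec Bool._≟_

pairCount : ∀ {N} → Fin N → Fin N → List (Subset N) → ℕ
pairCount x y Bs = count (λ b → (x ∈? b) ×-dec (y ∈? b)) Bs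

IsSTS : ∀ {N} → Subset N → List (Subset N) → Set
IsSTS W Bs =
  Unique Bs ×
  All (λ b → ∣ b ∣ ≡ 3 × b ⊆ W) Bs ×
  (∀ x y → x ∈ W → y ∈ W → x ≢ y → pairCount x y Bs ≡ 1)

IsOneFactor : ∀ {N} → Subset N → List (Subset N) → Set
IsOneFactor W F =
  All (λ e → ∣ e ∣ ≡ 2 × e ⊆ W) F ×
  (∀ y → y ∈ W → count (y ∈?_) F ≡ 1)

IsOneFactorization : ∀ {N} → Subset N → Subset N → (Fin N → List (Subset N)) → Set
IsOneFactorization {N} W I F =
  (∀ x → x ∈ I → IsOneFactor W (F x)) ×
  (∀ e → ∣ e ∣ ≡ 2 → e ⊆ W →
     count (λ x → (x ∈? I) ×-dec Data.List.Membership.DecPropositional._∈?_ _≟s_ e (F x)) (allFin N) ≡ 1)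
  where import Data.List.Membership.DecPropositional

IsTD3 : ∀ {N} → ℕ → Subset N → Subset N → Subset N → List (Subset N) → Set
IsTD3 g G₁ G₂ G₃ L =
  ∣ G₁ ∣ ≡ g × ∣ G₂ ∣ ≡ g × ∣ G₃ ∣ ≡ g ×
  (∀ x → x ∈ G₁ → x ∉ G₂) × (∀ x → x ∈ G₁ → x ∉ G₃) × (∀ x → x ∈ G₂ → x ∉ G₃) ×
  Unique L ×
  All (λ b → ∣ b ∣ ≡ 3 × ∣ b ∩ G₁ ∣ ≡ 1 × ∣ b ∩ G₂ ∣ ≡ 1 × ∣ b ∩ G₃ ∣ ≡ 1) L ×
  (∀ x y → (x ∈ G₁ × y ∈ G₂) ⊎ (x ∈ G₁ × y ∈ G₃) ⊎ (x ∈ G₂ × y ∈ G₃) →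
     pairCount x y L ≡ 1)

module Classes {N m : ℕ} (col : Fin N → GF2 m) where

  InB0? : (b : Subset N) → Dec (b ⊆ V0 col)
  InB0? b = b ⊆? V0 col

  TypeU : GF2 m → Subset N → Set
  TypeU u b = ∣ b ∩ V0 col ∣ ≡ 1 × ∣ b ∩ G col u ∣ ≡ 2

  TypeU? : (u : GF2 m) → Decidable (TypeU u)
  TypeU? u b = (∣ b ∩ V0 col ∣ Nat.≟ 1) ×-dec (∣ b ∩ G col u ∣ Nat.≟ 2)

  TypeL : GF2 m → GF2 m → Subset N → Set
  TypeL a c b = ∣ b ∩ G col a ∣ ≡ 1 × ∣ b ∩ G col c ∣ ≡ 1 × ∣ b ∩ G col (a ⊕ c) ∣ ≡ 1

  TypeL? : (a c : GF2 m) → Decidable (TypeL a c)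
  TypeL? a c b = (∣ b ∩ G col a ∣ Nat.≟ 1) ×-dec (∣ b ∩ G col c ∣ Nat.≟ 1)
                   ×-dec (∣ b ∩ G col (a ⊕ c) ∣ Nat.≟ 1)

  B₀ : List (Subset N) → List (Subset N)
  B₀ Bs = filter InB0? Bs

  Bu : GF2 m → List (Subset N) → List (Subset N)
  Bu u Bs = filter (TypeU? u) Bs

  Bℓ : GF2 m → GF2 m → List (Subset N) → List (Subset N)
  Bℓ a c Bs = filter (TypeL? a c) Bs

  Fu : GF2 m → List (Subset N) → Fin N → List (Subset N)
  Fu u Bs x = map (λ b → b ─ ⁅ x ⁆) (filter (x ∈?_) (Bu u Bs))

  Conclusion : ℕ → List (Subset N) → Set
  Conclusion t Bs =
    All (λ b → b ⊆ V0 col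
               ⊎ Σ (GF2 m) (λ u → Nonzero u × TypeU u b)
               ⊎ Σ (GF2 m) (λ a → Σ (GF2 m) (λ c → Nonzero a × Nonzero c × a ≢ c × TypeL a c b))) Bs ×
    (length (B₀ Bs) ≡ T * (T ∸ 1) / 6 × IsSTS (V0 col) (B₀ Bs)) ×
    (∀ u → Nonzero u →
       length (Bu u Bs) ≡ T * (T + 1) / 2 ×
       (∀ x → x ∈ V0 col → count (x ∈?_) (Bu u Bs) ≡ 2 ^ (t ∸ 1)) ×
       IsOneFactorization (G col u) (V0 col) (Fu u Bs)) ×
    (∀ a c → Nonzero a → Nonzero c → a ≢ c →
       length (Bℓ a c Bs) ≡ 2 ^ (2 * t) ×
       IsTD3 (T + 1) (G col a) (G col c) (G col (a ⊕ c)) (Bℓ a c Bs))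
    where
    T : ℕ
    T = 2 ^ t ∸ 1

-- A weight-3 codeword of C is a triple {x, y, z} of column indices with col z = col x ⊕ col y.
-- Sorting the columns of two of its points shows that every block of 𝒮 lies in V₀, or meets V₀
-- once and one G u twice, or meets G a, G c and G (a ⊕ c) once each, and that the block through
-- two points of given classes has the expected type. Since H_{n,t} has 2^t columns equal to each
-- nonzero u and 2^t - 1 zero columns, double counting the blocks through a point and the
-- point-block incidences yields all the sizes. The block through an edge {y, y′} of G u has its
-- third point in V₀, so every edge lies in exactly one of the 1-factors.

module Submission where

open import Defs
open import Data.Bool using (Bool; true; false; _∧_; if_then_else_)
import Data.Bool as Bool
open import Data.Bool.Properties using (xor-assoc; xor-comm; xor-same; ∧-idem)
open import Data.Empty using (⊥-elim)
open import Data.Fin using (Fin; punchIn)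
import Data.Fin as Fin
import Data.Fin.Properties as Finₚ
open import Data.Fin.Subset using (Subset; inside; outside; _∈_; _∉_; _⊆_; ∣_∣; _∩_; _─_; _-_; ⁅_⁆; ⊤; ⊥)
open import Data.Fin.Subset.Properties
  using ( _∈?_; ∈⊤; ∉⊥; ∣⊥∣≡0; Empty-unique; ⊆-antisym; x∈p∧x≢y⇒x∈p-y; p─q⊆p; p─⊥≡p; p∩q⊆p; x∈p∩q⁺; ∩⇔×
        ; ∩-identityʳ; ∩-zeroˡ)
open import Data.List using (List; []; _∷_; length; filter; map; allFin)
open import Data.List.Membership.Propositional using () renaming (_∈_ to _∈ₗ_)
open import Data.List.Membership.Propositional.Properties using (∈-filter⁺; ∈-filter⁻; ∈-map⁺; ∈-map⁻)
import Data.List.Membership.DecPropositional as DecMembership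
open import Data.List.Relation.Unary.All using (All; []; _∷_)
import Data.List.Relation.Unary.All as All
open import Data.List.Relation.Unary.All.Properties using () renaming (map⁺ to All-map⁺)
open import Data.List.Relation.Unary.Any using (here)
open import Data.List.Relation.Unary.Unique.Propositional.Properties using (filter⁺)
open import Data.Nat using (ℕ; zero; suc; _+_; _*_; _∸_; _^_; _≤_; _/_; s≤s; z≤n; s<s⁻¹)
open import Data.Nat.DivMod using (m*n/n≡m)
open import Data.Nat.Properties
open import Data.Nat.Solver using (module +-*-Solver)
open +-*-Solver using (solve; _:+_; _:*_; _:=_; con)
open import Data.Product using (Σ; _×_; _,_; ∃; ∃₂; proj₁; proj₂; map₁)
open import Data.Sum using (_⊎_; inj₁; inj₂; [_,_]′; map₂; swap)
open import Data.Vec using (Vec; []; _∷_; tabulate; lookup; here; there)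
open import Data.Vec.Functional using (removeAt)
open import Data.Vec.Properties
  using (lookup⇒[]=; []=⇒lookup; lookup∘tabulate; tabulate-cong; tabulate∘lookup; lookup-replicate)
open import Function using (_∘_; _⇔_; mk⇔)
open import Relation.Binary.PropositionalEquality
open import Relation.Nullary using (Dec; yes; no; ¬_; does)
open import Relation.Nullary.Decidable using (dec-true; dec-false; does-⇔; _×-dec_)
open import Relation.Unary using (Decidable)
open import Algebra.Properties.CommutativeSemigroup *-commutativeSemigroup using (xy∙z≈xz∙y; x∙yz≈y∙xz)
open import Algebra.Properties.CommutativeSemigroup +-commutativeSemigroup using () renaming (interchange to +-interchange)
open import Algebra.Properties.Semiring.Sum +-*-semiring
  using (sum; sum-syntax; sum-cong-≗; ∑-distrib-+; *-distribˡ-sum; *-distribʳ-sum; sum-replicate-zero; sum-remove)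

open ≡-Reasoning

𝟙 : Bool → ℕ
𝟙 true  = 1
𝟙 false = 0

𝟙[_] : ∀ {p} {P : Set p} → Dec P → ℕ
𝟙[ P? ] = 𝟙 (does P?)

𝟙-∧ : ∀ a b → 𝟙 (a ∧ b) ≡ 𝟙 a * 𝟙 b
𝟙-∧ true  b = sym (+-identityʳ (𝟙 b))
𝟙-∧ false b = refl

𝟙[]-yes : ∀ {p} {P : Set p} (P? : Dec P) → P → 𝟙[ P? ] ≡ 1
𝟙[]-yes P? p = cong 𝟙 (dec-true P? p)

𝟙[]-no : ∀ {p} {P : Set p} (P? : Dec P) → ¬ P → 𝟙[ P? ] ≡ 0
𝟙[]-no P? ¬p = cong 𝟙 (dec-false P? ¬p)

⊕-comm : ∀ {k} (x y : GF2 k) → x ⊕ y ≡ y ⊕ x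
⊕-comm []      []      = refl
⊕-comm (a ∷ x) (b ∷ y) = cong₂ _∷_ (xor-comm a b) (⊕-comm x y)

⊕-assoc : ∀ {k} (x y z : GF2 k) → (x ⊕ y) ⊕ z ≡ x ⊕ (y ⊕ z)
⊕-assoc []      []      []      = refl
⊕-assoc (a ∷ x) (b ∷ y) (c ∷ z) = cong₂ _∷_ (xor-assoc a b c) (⊕-assoc x y z)

⊕-identityˡ : ∀ {k} (x : GF2 k) → 0v ⊕ x ≡ x
⊕-identityˡ []      = refl
⊕-identityˡ (a ∷ x) = cong (a ∷_) (⊕-identityˡ x)

⊕-identityʳ : ∀ {k} (x : GF2 k) → x ⊕ 0v ≡ x
⊕-identityʳ x = trans (⊕-comm x 0v) (⊕-identityˡ x)

⊕-self : ∀ {k} (x : GF2 k) → x ⊕ x ≡ 0v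
⊕-self []      = refl
⊕-self (a ∷ x) = cong₂ _∷_ (xor-same a) (⊕-self x)

⊕-cancelˡ : ∀ {k} (x y : GF2 k) → x ⊕ (x ⊕ y) ≡ y
⊕-cancelˡ x y = begin
  x ⊕ (x ⊕ y)  ≡⟨ ⊕-assoc x x y ⟨
  (x ⊕ x) ⊕ y  ≡⟨ cong (_⊕ y) (⊕-self x) ⟩
  0v ⊕ y       ≡⟨ ⊕-identityˡ y ⟩
  y            ∎

⊕-cancelʳ : ∀ {k} (x y : GF2 k) → x ⊕ (y ⊕ x) ≡ y
⊕-cancelʳ x y = trans (cong (x ⊕_) (⊕-comm y x)) (⊕-cancelˡ x y)

⊕-solveʳ : ∀ {k} {x y z : GF2 k} → z ≡ x ⊕ y → y ≡ x ⊕ z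
⊕-solveʳ {x = x} {y} refl = sym (⊕-cancelˡ x y)

⊕≡0v⇒≡ : ∀ {k} {x y : GF2 k} → x ⊕ y ≡ 0v → x ≡ y
⊕≡0v⇒≡ {x = x} {y} h = trans (sym (⊕-identityʳ x)) (sym (⊕-solveʳ (sym h)))

⊕≡ˡ⇒≡0v : ∀ {k} {x y : GF2 k} → x ⊕ y ≡ x → y ≡ 0v
⊕≡ˡ⇒≡0v {x = x} {y} h = trans (sym (⊕-cancelˡ x y)) (trans (cong (x ⊕_) h) (⊕-self x))

⊕≡ʳ⇒≡0v : ∀ {k} {x y : GF2 k} → x ⊕ y ≡ y → x ≡ 0v
⊕≡ʳ⇒≡0v {x = x} {y} h = ⊕≡ˡ⇒≡0v (trans (⊕-comm y x) h)

⊕-leftComm : ∀ {k} (x y z : GF2 k) → x ⊕ (y ⊕ z) ≡ y ⊕ (x ⊕ z)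
⊕-leftComm x y z = begin
  x ⊕ (y ⊕ z)  ≡⟨ ⊕-assoc x y z ⟨
  (x ⊕ y) ⊕ z  ≡⟨ cong (_⊕ z) (⊕-comm x y) ⟩
  (y ⊕ x) ⊕ z  ≡⟨ ⊕-assoc y x z ⟩
  y ⊕ (x ⊕ z)  ∎

χ : ∀ {N} → Subset N → Fin N → ℕ
χ s i = 𝟙[ i ∈? s ]

∣∣≡∑χ : ∀ {N} (s : Subset N) → ∣ s ∣ ≡ ∑[ i < N ] χ s i
∣∣≡∑χ []            = refl
∣∣≡∑χ (inside  ∷ s) = cong suc (∣∣≡∑χ s)
∣∣≡∑χ (outside ∷ s) = ∣∣≡∑χ s

χ-∩ : ∀ {N} (s W : Subset N) i → χ (s ∩ W) i ≡ χ s i * χ W i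
χ-∩ s W i = trans (cong 𝟙 (does-⇔ ∩⇔× (i ∈? s ∩ W) ((i ∈? s) ×-dec (i ∈? W))))
                  (𝟙-∧ (does (i ∈? s)) (does (i ∈? W)))

∣∩∣≡∑χχ : ∀ {N} (s W : Subset N) → ∣ s ∩ W ∣ ≡ ∑[ i < N ] (χ s i * χ W i)
∣∩∣≡∑χχ s W = trans (∣∣≡∑χ (s ∩ W)) (sum-cong-≗ (χ-∩ s W))

x∉p-x : ∀ {N} (p : Subset N) (x : Fin N) → x ∉ p - x
x∉p-x (s ∷ p) Fin.zero    ()
x∉p-x (s ∷ p) (Fin.suc x) (there x∈p-x) = x∉p-x p x x∈p-x

x∈p-y⇒x≢y : ∀ {N} {p : Subset N} {x y} → x ∈ p - y → x ≢ y
x∈p-y⇒x≢y {p = p} x∈p-x refl = x∉p-x p _ x∈p-x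

x∈p-y⇒x∈p : ∀ {N} {p : Subset N} {x y} → x ∈ p - y → x ∈ p
x∈p-y⇒x∈p {p = p} {y = y} = p─q⊆p p ⁅ y ⁆

x≡y⊎x∈p-y : ∀ {N} {p : Subset N} {x} (y : Fin N) → x ∈ p → x ≡ y ⊎ x ∈ p - y
x≡y⊎x∈p-y {x = x} y x∈p with x Finₚ.≟ y
... | yes x≡y = inj₁ x≡y
... | no  x≢y = inj₂ (x∈p∧x≢y⇒x∈p-y x∈p x≢y)

∣∩∣-remove : ∀ {N} {p : Subset N} {x} (W : Subset N) → x ∈ p →
             ∣ p ∩ W ∣ ≡ χ W x + ∣ (p - x) ∩ W ∣
∣∩∣-remove {p = inside ∷ p} (inside  ∷ W) here = cong (λ q → suc ∣ q ∩ W ∣) (sym (p─⊥≡p p))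
∣∩∣-remove {p = inside ∷ p} (outside ∷ W) here = cong (λ q → ∣ q ∩ W ∣) (sym (p─⊥≡p p))
∣∩∣-remove {p = inside  ∷ p} (inside  ∷ W) (there x∈p) =
  trans (cong suc (∣∩∣-remove W x∈p)) (sym (+-suc _ _))
∣∩∣-remove {p = inside  ∷ p} (outside ∷ W) (there x∈p) = ∣∩∣-remove W x∈p
∣∩∣-remove {p = outside ∷ p} (w       ∷ W) (there x∈p) = ∣∩∣-remove W x∈p

∣p∣≡1+∣p-x∣ : ∀ {N} {p : Subset N} {x} → x ∈ p → ∣ p ∣ ≡ suc ∣ p - x ∣
∣p∣≡1+∣p-x∣ {p = p} {x} x∈p = begin
  ∣ p ∣                ≡⟨ cong ∣_∣ (∩-identityʳ p) ⟨
  ∣ p ∩ ⊤ ∣            ≡⟨ ∣∩∣-remove ⊤ x∈p ⟩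
  χ ⊤ x + ∣ (p - x) ∩ ⊤ ∣ ≡⟨ cong₂ _+_ (𝟙[]-yes (x ∈? ⊤) ∈⊤) (cong ∣_∣ (∩-identityʳ (p - x))) ⟩
  suc ∣ p - x ∣         ∎

nonempty : ∀ {N} (p : Subset N) {k} → ∣ p ∣ ≡ suc k → ∃ λ x → x ∈ p
nonempty (inside  ∷ p) _   = Fin.zero , here
nonempty (outside ∷ p) ∣p∣ = let x , x∈p = nonempty p ∣p∣ in Fin.suc x , there x∈p

∣p∣≡0⇒p≡⊥ : ∀ {N} {p : Subset N} → ∣ p ∣ ≡ 0 → p ≡ ⊥
∣p∣≡0⇒p≡⊥ ∣p∣≡0 = Empty-unique λ (x , x∈p) → 1+n≢0 (trans (sym (∣p∣≡1+∣p-x∣ x∈p)) ∣p∣≡0)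

pick : ∀ {N} (p : Subset N) {k} → ∣ p ∣ ≡ suc k → ∃ λ x → x ∈ p × ∣ p - x ∣ ≡ k
pick p ∣p∣≡1+k = let x , x∈p = nonempty p ∣p∣≡1+k in
  x , x∈p , suc-injective (trans (sym (∣p∣≡1+∣p-x∣ x∈p)) ∣p∣≡1+k)

p-y-y′≡⊥⇒≡y⊎≡y′ : ∀ {N} {p : Subset N} {y y′} → p - y - y′ ≡ ⊥ → ∀ {i} → i ∈ p → i ≡ y ⊎ i ≡ y′
p-y-y′≡⊥⇒≡y⊎≡y′ {y = y} {y′} p-y-y′≡⊥ i∈p with x≡y⊎x∈p-y y i∈p
... | inj₁ i≡y   = inj₁ i≡y
... | inj₂ i∈p-y with x≡y⊎x∈p-y y′ i∈p-y
...   | inj₁ i≡y′     = inj₂ i≡y′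
...   | inj₂ i∈p-y-y′ = ⊥-elim (∉⊥ (subst (_ ∈_) p-y-y′≡⊥ i∈p-y-y′))

IsPair : ∀ {N} → Subset N → Fin N → Fin N → Set
IsPair e y y′ = y ∈ e × y′ ∈ e × y ≢ y′ × (∀ {i} → i ∈ e → i ≡ y ⊎ i ≡ y′)

∣p∣≡2⇒pair : ∀ {N} {e : Subset N} → ∣ e ∣ ≡ 2 → ∃₂ (IsPair e)
∣p∣≡2⇒pair {e = e} ∣e∣≡2
  with y , y∈e , ∣e-y∣≡1 ← pick e ∣e∣≡2
  with y′ , y′∈e-y , ∣e-y-y′∣≡0 ← pick (e - y) ∣e-y∣≡1
  = y , y′ , y∈e , x∈p-y⇒x∈p y′∈e-y , ≢-sym (x∈p-y⇒x≢y y′∈e-y) , p-y-y′≡⊥⇒≡y⊎≡y′ (∣p∣≡0⇒p≡⊥ ∣e-y-y′∣≡0)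

⊆⇒∩≡ : ∀ {N} {p W : Subset N} → p ⊆ W → p ∩ W ≡ p
⊆⇒∩≡ {p = p} {W} p⊆W = ⊆-antisym (p∩q⊆p p W) (λ x∈p → x∈p∩q⁺ (x∈p , p⊆W x∈p))

χ+χ≡2 : ∀ {N} (W : Subset N) {v w} → χ W v + χ W w ≡ 2 → v ∈ W × w ∈ W
χ+χ≡2 W {v} {w} sum≡2 with v ∈? W | w ∈? W
... | yes v∈W | yes w∈W = v∈W , w∈W
... | yes _   | no  _   = ⊥-elim (0≢1+n (suc-injective sum≡2))
... | no  _   | yes _   = ⊥-elim (0≢1+n (suc-injective sum≡2))
... | no  _   | no  _   = ⊥-elim (0≢1+n sum≡2)

syndrome-⊥ : ∀ {N m} (col : Fin N → GF2 m) → syndrome col ⊥ ≡ 0v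
syndrome-⊥ {zero}  col = refl
syndrome-⊥ {suc N} col = trans (⊕-identityˡ _) (syndrome-⊥ (col ∘ Fin.suc))

syndrome-remove : ∀ {N m} (col : Fin N → GF2 m) {p x} → x ∈ p →
                  syndrome col p ≡ col x ⊕ syndrome col (p - x)
syndrome-remove col {inside ∷ p} here = cong (col Fin.zero ⊕_) (begin
  syndrome (col ∘ Fin.suc) p             ≡⟨ cong (syndrome (col ∘ Fin.suc)) (p─⊥≡p p) ⟨
  syndrome (col ∘ Fin.suc) (p ─ ⊥)       ≡⟨ ⊕-identityˡ _ ⟨
  0v ⊕ syndrome (col ∘ Fin.suc) (p ─ ⊥)  ∎)
syndrome-remove {m = m} col {s ∷ p} {Fin.suc x} (there x∈p) =
  trans (cong (head ⊕_) (syndrome-remove (col ∘ Fin.suc) x∈p))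
        (⊕-leftComm head (col (Fin.suc x)) _)
  where
  head : GF2 m
  head = if s then col Fin.zero else 0v

record IsTriple {N m} (col : Fin N → GF2 m) (b : Subset N) (x y z : Fin N) : Set where
  field
    x∈b   : x ∈ b
    y∈b   : y ∈ b
    z∈b   : z ∈ b
    x≢y   : x ≢ y
    x≢z   : x ≢ z
    y≢z   : y ≢ z
    ⊆xyz  : ∀ {i} → i ∈ b → i ≡ x ⊎ i ≡ y ⊎ i ≡ z
    col-z : col z ≡ col x ⊕ col y

module _ {N m} {col : Fin N → GF2 m} {b : Subset N} where

  peeled⇒triple : ∀ {x y z} → x ∈ b → y ∈ b - x → z ∈ b - x - y → b - x - y - z ≡ ⊥ →
                  IsCodeword col b → IsTriple col b x y z
  peeled⇒triple {x} {y} {z} x∈b y∈b-x z∈b-x-y b-x-y-z≡⊥ codeword = record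
    { x∈b = x∈b ; y∈b = x∈p-y⇒x∈p y∈b-x ; z∈b = x∈p-y⇒x∈p (x∈p-y⇒x∈p z∈b-x-y)
    ; x≢y = ≢-sym (x∈p-y⇒x≢y y∈b-x)
    ; x≢z = ≢-sym (x∈p-y⇒x≢y (x∈p-y⇒x∈p z∈b-x-y))
    ; y≢z = ≢-sym (x∈p-y⇒x≢y z∈b-x-y)
    ; ⊆xyz = ⊆xyz ; col-z = sym (⊕≡0v⇒≡ sum≡0v) }
    where
    ⊆xyz : ∀ {i} → i ∈ b → i ≡ x ⊎ i ≡ y ⊎ i ≡ z
    ⊆xyz i∈b with x≡y⊎x∈p-y x i∈b
    ... | inj₁ i≡x   = inj₁ i≡x
    ... | inj₂ i∈b-x = inj₂ (p-y-y′≡⊥⇒≡y⊎≡y′ b-x-y-z≡⊥ i∈b-x)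
    sum≡0v : (col x ⊕ col y) ⊕ col z ≡ 0v
    sum≡0v = begin
      (col x ⊕ col y) ⊕ col z                               ≡⟨ ⊕-assoc (col x) (col y) (col z) ⟩
      col x ⊕ (col y ⊕ col z)                               ≡⟨ cong (λ s → col x ⊕ (col y ⊕ s)) (⊕-identityʳ (col z)) ⟨
      col x ⊕ (col y ⊕ (col z ⊕ 0v))                        ≡⟨ cong (λ s → col x ⊕ (col y ⊕ (col z ⊕ s))) syndrome-rest ⟨
      col x ⊕ (col y ⊕ (col z ⊕ syndrome col (b - x - y - z))) ≡⟨ syndrome-peeled ⟨
      syndrome col b                                        ≡⟨ codeword ⟩
      0v                                                    ∎
      where
      syndrome-rest : syndrome col (b - x - y - z) ≡ 0v
      syndrome-rest = trans (cong (syndrome col) b-x-y-z≡⊥) (syndrome-⊥ col)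
      syndrome-peeled : syndrome col b ≡ col x ⊕ (col y ⊕ (col z ⊕ syndrome col (b - x - y - z)))
      syndrome-peeled = trans (syndrome-remove col x∈b) (cong (col x ⊕_)
        (trans (syndrome-remove col y∈b-x) (cong (col y ⊕_) (syndrome-remove col z∈b-x-y))))

  dblock⇒triple : IsDBlock col b → ∃ λ x → ∃₂ λ y z → IsTriple col b x y z
  dblock⇒triple (codeword , ∣b∣≡3)
    with x , x∈b , ∣b-x∣≡2 ← pick b ∣b∣≡3
    with y , y∈b-x , ∣b-x-y∣≡1 ← pick (b - x) ∣b-x∣≡2
    with z , z∈b-x-y , ∣b-x-y-z∣≡0 ← pick (b - x - y) ∣b-x-y∣≡1
    = x , y , z , peeled⇒triple x∈b y∈b-x z∈b-x-y (∣p∣≡0⇒p≡⊥ ∣b-x-y-z∣≡0) codeword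

  IsTriple-swap₁₂ : ∀ {x y z} → IsTriple col b x y z → IsTriple col b y x z
  IsTriple-swap₁₂ t = record
    { x∈b = y∈b ; y∈b = x∈b ; z∈b = z∈b ; x≢y = ≢-sym x≢y ; x≢z = y≢z ; y≢z = x≢z
    ; ⊆xyz = [ inj₂ ∘ inj₁ , map₂ inj₂ ]′ ∘ ⊆xyz
    ; col-z = trans col-z (⊕-comm (col _) (col _)) }
    where open IsTriple t

  IsTriple-swap₂₃ : ∀ {x y z} → IsTriple col b x y z → IsTriple col b x z y
  IsTriple-swap₂₃ t = record
    { x∈b = x∈b ; y∈b = z∈b ; z∈b = y∈b ; x≢y = x≢z ; x≢z = x≢y ; y≢z = ≢-sym y≢z
    ; ⊆xyz = map₂ swap ∘ ⊆xyz
    ; col-z = ⊕-solveʳ col-z }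
    where open IsTriple t

  triple-from : ∀ {x y z u} → IsTriple col b x y z → u ∈ b → ∃₂ λ v w → IsTriple col b u v w
  triple-from t u∈b with IsTriple.⊆xyz t u∈b
  ... | inj₁ refl        = _ , _ , t
  ... | inj₂ (inj₁ refl) = _ , _ , IsTriple-swap₁₂ t
  ... | inj₂ (inj₂ refl) = _ , _ , IsTriple-swap₁₂ (IsTriple-swap₂₃ t)

  triple-through : ∀ {x y z u v} → IsTriple col b x y z → u ∈ b → v ∈ b → u ≢ v →
                   ∃ λ w → IsTriple col b u v w
  triple-through t u∈b v∈b u≢v with triple-from t u∈b
  ... | v′ , w′ , t′ with IsTriple.⊆xyz t′ v∈b
  ...   | inj₁ refl        = ⊥-elim (u≢v refl)
  ...   | inj₂ (inj₁ refl) = w′ , t′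
  ...   | inj₂ (inj₂ refl) = v′ , IsTriple-swap₂₃ t′

  dblock-from : ∀ {u} → IsDBlock col b → u ∈ b → ∃₂ λ v w → IsTriple col b u v w
  dblock-from d = let _ , _ , _ , t = dblock⇒triple d in triple-from t

  dblock-through : ∀ {u v} → IsDBlock col b → u ∈ b → v ∈ b → u ≢ v →
                   ∃ λ w → IsTriple col b u v w
  dblock-through d = let _ , _ , _ , t = dblock⇒triple d in triple-through t

  pair≡b-z : ∀ {x y z e} → IsTriple col b x y z → IsPair e x y → e ≡ b - z
  pair≡b-z {x} {y} {z} {e} t (x∈e , y∈e , _ , e⊆xy) = ⊆-antisym e⊆b-z b-z⊆e
    where
    open IsTriple t
    e⊆b-z : e ⊆ b - z
    e⊆b-z i∈e with e⊆xy i∈e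
    ... | inj₁ refl = x∈p∧x≢y⇒x∈p-y x∈b x≢z
    ... | inj₂ refl = x∈p∧x≢y⇒x∈p-y y∈b y≢z
    b-z⊆e : b - z ⊆ e
    b-z⊆e i∈b-z with ⊆xyz (x∈p-y⇒x∈p i∈b-z)
    ... | inj₁ refl        = x∈e
    ... | inj₂ (inj₁ refl) = y∈e
    ... | inj₂ (inj₂ i≡z)  = ⊥-elim (x∈p-y⇒x≢y i∈b-z i≡z)

  triple-∣∩∣ : ∀ {x y z} → IsTriple col b x y z → (W : Subset N) →
               ∣ b ∩ W ∣ ≡ χ W x + (χ W y + χ W z)
  triple-∣∩∣ {x} {y} {z} t W = begin
    ∣ b ∩ W ∣                                       ≡⟨ ∣∩∣-remove W x∈b ⟩
    χ W x + ∣ (b - x) ∩ W ∣                         ≡⟨ cong (χ W x +_) (∣∩∣-remove W y∈b-x) ⟩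
    χ W x + (χ W y + ∣ (b - x - y) ∩ W ∣)           ≡⟨ cong (λ s → χ W x + (χ W y + s)) (∣∩∣-remove W z∈b-x-y) ⟩
    χ W x + (χ W y + (χ W z + ∣ (b - x - y - z) ∩ W ∣)) ≡⟨ cong (λ s → χ W x + (χ W y + (χ W z + s))) rest≡0 ⟩
    χ W x + (χ W y + (χ W z + 0))                   ≡⟨ cong (λ s → χ W x + (χ W y + s)) (+-identityʳ (χ W z)) ⟩
    χ W x + (χ W y + χ W z)                         ∎
    where
    open IsTriple t
    y∈b-x : y ∈ b - x
    y∈b-x = x∈p∧x≢y⇒x∈p-y y∈b (≢-sym x≢y)
    z∈b-x-y : z ∈ b - x - y
    z∈b-x-y = x∈p∧x≢y⇒x∈p-y (x∈p∧x≢y⇒x∈p-y z∈b (≢-sym x≢z)) (≢-sym y≢z)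
    b-x-y-z≡⊥ : b - x - y - z ≡ ⊥
    b-x-y-z≡⊥ = Empty-unique λ (i , i∈b-x-y-z) →
      let i∈b-x-y = x∈p-y⇒x∈p i∈b-x-y-z ; i∈b-x = x∈p-y⇒x∈p i∈b-x-y in
      [ x∈p-y⇒x≢y i∈b-x , [ x∈p-y⇒x≢y i∈b-x-y , x∈p-y⇒x≢y i∈b-x-y-z ]′ ]′ (⊆xyz (x∈p-y⇒x∈p i∈b-x))
    rest≡0 : ∣ (b - x - y - z) ∩ W ∣ ≡ 0
    rest≡0 = trans (cong (λ q → ∣ q ∩ W ∣) b-x-y-z≡⊥) (trans (cong ∣_∣ (∩-zeroˡ W)) (∣⊥∣≡0 N))

module _ {N m} (col : Fin N → GF2 m) {u : GF2 m} {i : Fin N} where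

  ∈G⁺ : col i ≡ u → i ∈ G col u
  ∈G⁺ coli≡u = lookup⇒[]= i (G col u) (trans (lookup∘tabulate _ i) (dec-true (col i ≟v u) coli≡u))

  ∈G⁻ : i ∈ G col u → col i ≡ u
  ∈G⁻ i∈G with col i ≟v u | trans (sym (lookup∘tabulate (λ j → does (col j ≟v u)) i)) ([]=⇒lookup i∈G)
  ... | yes coli≡u | _  = coli≡u
  ... | no  _      | ()

  χG≡𝟙 : χ (G col u) i ≡ 𝟙[ col i ≟v u ]
  χG≡𝟙 = cong 𝟙 (does-⇔ (mk⇔ ∈G⁻ ∈G⁺) (i ∈? G col u) (col i ≟v u))

module _ {N m} (col : Fin N → GF2 m) {u : GF2 m} (i : Fin N) where

  χG≡1 : col i ≡ u → χ (G col u) i ≡ 1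
  χG≡1 coli≡u = 𝟙[]-yes (i ∈? G col u) (∈G⁺ col coli≡u)

  χG≡0 : col i ≢ u → χ (G col u) i ≡ 0
  χG≡0 coli≢u = 𝟙[]-no (i ∈? G col u) (coli≢u ∘ ∈G⁻ col)

module _ {N m} {col : Fin N → GF2 m} {b : Subset N} {x y z : Fin N} (t : IsTriple col b x y z) where
  open IsTriple t
  open Classes col

  triple⊆V₀ : col x ≡ 0v → col y ≡ 0v → b ⊆ V0 col
  triple⊆V₀ colx≡0 coly≡0 i∈b with ⊆xyz i∈b
  ... | inj₁ refl        = ∈G⁺ col colx≡0
  ... | inj₂ (inj₁ refl) = ∈G⁺ col coly≡0
  ... | inj₂ (inj₂ refl) = ∈G⁺ col (trans col-z (trans (cong₂ _⊕_ colx≡0 coly≡0) (⊕-identityˡ 0v)))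

  triple-typeU : ∀ {u} → Nonzero u → col x ≡ 0v → col y ≡ u → TypeU u b
  triple-typeU {u} u≢0 colx≡0 coly≡u = ∣b∩V₀∣≡1 , ∣b∩Gu∣≡2
    where
    colz≡u : col z ≡ u
    colz≡u = trans col-z (trans (cong₂ _⊕_ colx≡0 coly≡u) (⊕-identityˡ u))
    ∣b∩V₀∣≡1 : ∣ b ∩ V0 col ∣ ≡ 1
    ∣b∩V₀∣≡1 = trans (triple-∣∩∣ t (V0 col))
      (cong₂ _+_ (χG≡1 col x colx≡0) (cong₂ _+_ (χG≡0 col y (u≢0 ∘ trans (sym coly≡u))) (χG≡0 col z (u≢0 ∘ trans (sym colz≡u)))))
    ∣b∩Gu∣≡2 : ∣ b ∩ G col u ∣ ≡ 2
    ∣b∩Gu∣≡2 = trans (triple-∣∩∣ t (G col u))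
      (cong₂ _+_ (χG≡0 col x (λ colx≡u → u≢0 (trans (sym colx≡u) colx≡0))) (cong₂ _+_ (χG≡1 col y coly≡u) (χG≡1 col z colz≡u)))

  triple-typeL : ∀ {a c} → Nonzero a → Nonzero c → a ≢ c → col x ≡ a → col y ≡ c → TypeL a c b
  triple-typeL {a} {c} a≢0 c≢0 a≢c colx≡a coly≡c = ∣b∩Ga∣≡1 , ∣b∩Gc∣≡1 , ∣b∩Ga+c∣≡1
    where
    colz≡a+c : col z ≡ a ⊕ c
    colz≡a+c = trans col-z (cong₂ _⊕_ colx≡a coly≡c)
    ∣b∩Ga∣≡1 : ∣ b ∩ G col a ∣ ≡ 1
    ∣b∩Ga∣≡1 = trans (triple-∣∩∣ t (G col a)) (cong₂ _+_ (χG≡1 col x colx≡a) (cong₂ _+_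
      (χG≡0 col y (λ coly≡a → a≢c (trans (sym coly≡a) coly≡c)))
      (χG≡0 col z (λ colz≡a → c≢0 (⊕≡ˡ⇒≡0v (trans (sym colz≡a+c) colz≡a))))))
    ∣b∩Gc∣≡1 : ∣ b ∩ G col c ∣ ≡ 1
    ∣b∩Gc∣≡1 = trans (triple-∣∩∣ t (G col c)) (cong₂ _+_
      (χG≡0 col x (λ colx≡c → a≢c (trans (sym colx≡a) colx≡c)))
      (cong₂ _+_ (χG≡1 col y coly≡c) (χG≡0 col z (λ colz≡c → a≢0 (⊕≡ʳ⇒≡0v (trans (sym colz≡a+c) colz≡c))))))
    ∣b∩Ga+c∣≡1 : ∣ b ∩ G col (a ⊕ c) ∣ ≡ 1
    ∣b∩Ga+c∣≡1 = trans (triple-∣∩∣ t (G col (a ⊕ c))) (cong₂ _+_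
      (χG≡0 col x (λ colx≡a+c → c≢0 (⊕≡ˡ⇒≡0v (trans (sym colx≡a+c) colx≡a))))
      (cong₂ _+_ (χG≡0 col y (λ coly≡a+c → a≢0 (⊕≡ʳ⇒≡0v (trans (sym coly≡a+c) coly≡c)))) (χG≡1 col z colz≡a+c)))

module _ {N m} {col : Fin N → GF2 m} where
  open Classes col

  BlockClass : Subset N → Set
  BlockClass b = b ⊆ V0 col
               ⊎ Σ (GF2 m) (λ u → Nonzero u × TypeU u b)
               ⊎ Σ (GF2 m) (λ a → Σ (GF2 m) (λ c → Nonzero a × Nonzero c × a ≢ c × TypeL a c b))

  classify-triple : ∀ {b x y z} → IsTriple col b x y z →
                    Dec (col x ≡ 0v) → Dec (col y ≡ 0v) → Dec (col x ≡ col y) → BlockClass b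
  classify-triple t (yes colx≡0) (yes coly≡0) _ = inj₁ (triple⊆V₀ t colx≡0 coly≡0)
  classify-triple t (yes colx≡0) (no  coly≢0) _ = inj₂ (inj₁ (_ , coly≢0 , triple-typeU t coly≢0 colx≡0 refl))
  classify-triple t (no  colx≢0) (yes coly≡0) _ =
    inj₂ (inj₁ (_ , colx≢0 , triple-typeU (IsTriple-swap₁₂ t) colx≢0 coly≡0 refl))
  classify-triple t (no  colx≢0) (no  coly≢0) (no colx≢coly) =
    inj₂ (inj₂ (_ , _ , colx≢0 , coly≢0 , colx≢coly , triple-typeL t colx≢0 coly≢0 colx≢coly refl refl))
  classify-triple {x = x} {z = z} t (no  colx≢0) (no  _) (yes colx≡coly) =
    inj₂ (inj₁ (_ , colx≢0 , triple-typeU (IsTriple-swap₁₂ (IsTriple-swap₂₃ t)) colx≢0 colz≡0 refl))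
    where
    colz≡0 : col z ≡ 0v
    colz≡0 = trans (IsTriple.col-z t) (trans (cong (col x ⊕_) (sym colx≡coly)) (⊕-self (col x)))

  classify : ∀ {b} → IsDBlock col b → BlockClass b
  classify d = let x , y , _ , t = dblock⇒triple d in classify-triple t (col x ≟v 0v) (col y ≟v 0v) (col x ≟v col y)

∑-δ : ∀ {N} (z : Fin N) → ∑[ i < N ] 𝟙[ i Finₚ.≟ z ] ≡ 1
∑-δ {suc N} Fin.zero    = cong suc (sum-replicate-zero N)
∑-δ {suc N} (Fin.suc z) = ∑-δ z

∑-uniform : ∀ {N} (W : Subset N) (f : Fin N → ℕ) {c} → (∀ {i} → i ∈ W → f i ≡ c) →
            ∑[ i < N ] (f i * χ W i) ≡ c * ∣ W ∣
∑-uniform {N} W f {c} f≡c = begin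
  ∑[ i < N ] (f i * χ W i)  ≡⟨ sum-cong-≗ pointwise ⟩
  ∑[ i < N ] (c * χ W i)    ≡⟨ *-distribˡ-sum c (χ W) ⟨
  c * ∑[ i < N ] χ W i      ≡⟨ cong (c *_) (∣∣≡∑χ W) ⟨
  c * ∣ W ∣                 ∎
  where
  pointwise : ∀ i → f i * χ W i ≡ c * χ W i
  pointwise i with i ∈? W
  ... | yes i∈W = cong (_* 1) (f≡c i∈W)
  ... | no  _   = trans (*-zeroʳ (f i)) (sym (*-zeroʳ c))

∑-except : ∀ {N} {x : Fin N} (f g : Fin N → ℕ) → (∀ y → y ≢ x → f y ≡ g y) →
           sum f + g x ≡ f x + sum g
∑-except {suc N} {x} f g f≗g = begin
  sum f + g x                            ≡⟨ cong (_+ g x) (sum-remove {i = x} f) ⟩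
  f x + sum (removeAt f x) + g x         ≡⟨ cong (λ s → f x + s + g x) (sum-cong-≗ off-x) ⟩
  f x + sum (removeAt g x) + g x         ≡⟨ +-assoc (f x) _ (g x) ⟩
  f x + (sum (removeAt g x) + g x)       ≡⟨ cong (f x +_) (+-comm _ (g x)) ⟩
  f x + (g x + sum (removeAt g x))       ≡⟨ cong (f x +_) (sum-remove {i = x} g) ⟨
  f x + sum g                            ∎
  where
  off-x : ∀ j → f (punchIn x j) ≡ g (punchIn x j)
  off-x j = f≗g (punchIn x j) (Finₚ.punchInᵢ≢i x j)

count-∷ : ∀ {a p} {A : Set a} {P : A → Set p} (P? : Decidable P) x xs →
          count P? (x ∷ xs) ≡ 𝟙[ P? x ] + count P? xs
count-∷ P? x xs with does (P? x)
... | true  = refl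
... | false = refl

module _ {a p} {A : Set a} {P : A → Set p} (P? : Decidable P) where

  count-map : ∀ {b} {B : Set b} (f : B → A) xs → count P? (map f xs) ≡ count (P? ∘ f) xs
  count-map f []       = refl
  count-map f (x ∷ xs) = begin
    count P? (f x ∷ map f xs)         ≡⟨ count-∷ P? (f x) _ ⟩
    𝟙[ P? (f x) ] + count P? (map f xs) ≡⟨ cong (_ +_) (count-map f xs) ⟩
    𝟙[ P? (f x) ] + count (P? ∘ f) xs ≡⟨ count-∷ (P? ∘ f) x xs ⟨
    count (P? ∘ f) (x ∷ xs)           ∎

  count-tabulate : ∀ {N} (f : Fin N → A) → count P? (Data.List.tabulate f) ≡ ∑[ i < N ] 𝟙[ P? (f i) ]
  count-tabulate {zero}  f = refl
  count-tabulate {suc N} f = trans (count-∷ P? (f Fin.zero) _) (cong (_ +_) (count-tabulate (f ∘ Fin.suc)))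

  count-filter : ∀ {q} {Q : A → Set q} (Q? : Decidable Q) {xs} → All (λ x → P x → Q x) xs →
                 count P? (filter Q? xs) ≡ count P? xs
  count-filter Q? {[]}     []           = refl
  count-filter Q? {x ∷ xs} (P⇒Q ∷ P⇒Qs) with Q? x
  ... | yes _  = trans (count-∷ P? x _) (trans (cong (_ +_) (count-filter Q? P⇒Qs)) (sym (count-∷ P? x xs)))
  ... | no ¬Qx = trans (count-filter Q? P⇒Qs)
                       (sym (trans (count-∷ P? x xs) (cong (_+ _) (𝟙[]-no (P? x) (¬Qx ∘ P⇒Q)))))

  count-filter-∧ : ∀ {q} {Q : A → Set q} (Q? : Decidable Q) xs →
                   count P? (filter Q? xs) ≡ count (λ x → Q? x ×-dec P? x) xs
  count-filter-∧ Q? []       = refl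
  count-filter-∧ Q? (x ∷ xs) = trans at-x (sym (count-∷ (λ x → Q? x ×-dec P? x) x xs))
    where
    at-x : count P? (filter Q? (x ∷ xs)) ≡ 𝟙 (does (Q? x) ∧ does (P? x)) + count (λ x → Q? x ×-dec P? x) xs
    at-x with does (Q? x)
    ... | true  = trans (count-∷ P? x _) (cong (_ +_) (count-filter-∧ Q? xs))
    ... | false = count-filter-∧ Q? xs

  count≡1⇒∃ : ∀ {xs} → count P? xs ≡ 1 → ∃ λ x → x ∈ₗ xs × P x
  count≡1⇒∃ {xs} count≡1 with filter P? xs in eq
  ... | x ∷ [] = x , ∈-filter⁻ P? (subst (x ∈ₗ_) (sym eq) (here refl))

  count≡1⇒unique : ∀ {xs x y} → count P? xs ≡ 1 → x ∈ₗ xs → P x → y ∈ₗ xs → P y → x ≡ y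
  count≡1⇒unique {xs} count≡1 x∈xs Px y∈xs Py =
    singleton (filter P? xs) count≡1 (∈-filter⁺ P? x∈xs Px) (∈-filter⁺ P? y∈xs Py)
    where
    singleton : ∀ ys {x y} → length ys ≡ 1 → x ∈ₗ ys → y ∈ₗ ys → x ≡ y
    singleton (_ ∷ []) _ (here refl) (here refl) = refl

module _ {a p q} {A : Set a} {P : A → Set p} {Q : A → Set q} (P? : Decidable P) where

  count-cong : (Q? : Decidable Q) → (∀ x → does (P? x) ≡ does (Q? x)) → ∀ xs → count P? xs ≡ count Q? xs
  count-cong Q? P?≗Q? []       = refl
  count-cong Q? P?≗Q? (x ∷ xs) = begin
    count P? (x ∷ xs)            ≡⟨ count-∷ P? x xs ⟩
    𝟙[ P? x ] + count P? xs      ≡⟨ cong₂ _+_ (cong 𝟙 (P?≗Q? x)) (count-cong Q? P?≗Q? xs) ⟩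
    𝟙[ Q? x ] + count Q? xs      ≡⟨ count-∷ Q? x xs ⟨
    count Q? (x ∷ xs)            ∎

count-allFin : ∀ {p N} {P : Fin N → Set p} (P? : Decidable P) (z : Fin N) → (∀ x → P x ⇔ x ≡ z) →
               count P? (allFin N) ≡ 1
count-allFin {N = N} P? z P⇔≡z = begin
  count P? (allFin N)         ≡⟨ count-tabulate P? (λ i → i) ⟩
  ∑[ i < N ] 𝟙[ P? i ]        ≡⟨ sum-cong-≗ (λ i → cong 𝟙 (does-⇔ (P⇔≡z i) (P? i) (i Finₚ.≟ z))) ⟩
  ∑[ i < N ] 𝟙[ i Finₚ.≟ z ]  ≡⟨ ∑-δ z ⟩
  1                           ∎

module _ {N : ℕ} where

  pairCount-∷ : ∀ (x y : Fin N) b L → pairCount x y (b ∷ L) ≡ χ b x * χ b y + pairCount x y L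
  pairCount-∷ x y b L = trans (count-∷ (λ b → (x ∈? b) ×-dec (y ∈? b)) b L) (cong (_+ _) (𝟙-∧ (does (x ∈? b)) (does (y ∈? b))))

  pairCount-diag : ∀ (x : Fin N) L → pairCount x x L ≡ count (x ∈?_) L
  pairCount-diag x L = count-cong _ (x ∈?_) (λ b → ∧-idem (does (x ∈? b))) L

  count-remove : ∀ {x y : Fin N} L → y ≢ x →
                 count (y ∈?_) (map (_- x) (filter (x ∈?_) L)) ≡ pairCount x y L
  count-remove {x} {y} L y≢x = begin
    count (y ∈?_) (map (_- x) (filter (x ∈?_) L))      ≡⟨ count-map (y ∈?_) (_- x) (filter (x ∈?_) L) ⟩
    count (λ b → y ∈? b - x) (filter (x ∈?_) L)         ≡⟨ count-filter-∧ (λ b → y ∈? b - x) (x ∈?_) L ⟩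
    count (λ b → (x ∈? b) ×-dec (y ∈? b - x)) L         ≡⟨ count-cong _ _ (λ b → cong (does (x ∈? b) ∧_) (y∈b-x? b)) L ⟩
    pairCount x y L                                     ∎
    where
    y∈b-x? : ∀ b → does (y ∈? b - x) ≡ does (y ∈? b)
    y∈b-x? b = does-⇔ (mk⇔ x∈p-y⇒x∈p (λ y∈b → x∈p∧x≢y⇒x∈p-y y∈b y≢x)) (y ∈? b - x) (y ∈? b)

  ∑-pairCount : ∀ x {W : Subset N} {k} L → All (λ b → ∣ b ∩ W ∣ ≡ k) L →
                ∑[ y < N ] (pairCount x y L * χ W y) ≡ count (x ∈?_) L * k
  ∑-pairCount x []      []                    = sum-replicate-zero N
  ∑-pairCount x {W} {k} (b ∷ L) (∣b∩W∣≡k ∷ ∣L∩W∣≡k) = begin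
    ∑[ y < N ] (pairCount x y (b ∷ L) * χ W y)
      ≡⟨ sum-cong-≗ (λ y → trans (cong (_* χ W y) (pairCount-∷ x y b L)) (*-distribʳ-+ (χ W y) (χ b x * χ b y) _)) ⟩
    ∑[ y < N ] (χ b x * χ b y * χ W y + pairCount x y L * χ W y)
      ≡⟨ ∑-distrib-+ (λ y → χ b x * χ b y * χ W y) _ ⟩
    ∑[ y < N ] (χ b x * χ b y * χ W y) + ∑[ y < N ] (pairCount x y L * χ W y)
      ≡⟨ cong₂ _+_ through-b (∑-pairCount x L ∣L∩W∣≡k) ⟩
    χ b x * k + count (x ∈?_) L * k
      ≡⟨ *-distribʳ-+ k (χ b x) _ ⟨
    (χ b x + count (x ∈?_) L) * k
      ≡⟨ cong (_* k) (count-∷ (x ∈?_) b L) ⟨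
    count (x ∈?_) (b ∷ L) * k
      ∎
    where
    through-b : ∑[ y < N ] (χ b x * χ b y * χ W y) ≡ χ b x * k
    through-b = begin
      ∑[ y < N ] (χ b x * χ b y * χ W y)   ≡⟨ sum-cong-≗ (λ y → *-assoc (χ b x) (χ b y) (χ W y)) ⟩
      ∑[ y < N ] (χ b x * (χ b y * χ W y)) ≡⟨ *-distribˡ-sum (χ b x) (λ y → χ b y * χ W y) ⟨
      χ b x * ∑[ y < N ] (χ b y * χ W y)   ≡⟨ cong (χ b x *_) (trans (sym (∣∩∣≡∑χχ b W)) ∣b∩W∣≡k) ⟩
      χ b x * k                            ∎

  ∑-count : ∀ {W : Subset N} {k} L → All (λ b → ∣ b ∩ W ∣ ≡ k) L →
            ∑[ y < N ] (count (y ∈?_) L * χ W y) ≡ length L * k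
  ∑-count []      []                    = sum-replicate-zero N
  ∑-count {W} {k} (b ∷ L) (∣b∩W∣≡k ∷ ∣L∩W∣≡k) = begin
    ∑[ y < N ] (count (y ∈?_) (b ∷ L) * χ W y)
      ≡⟨ sum-cong-≗ (λ y → trans (cong (_* χ W y) (count-∷ (y ∈?_) b L)) (*-distribʳ-+ (χ W y) (χ b y) _)) ⟩
    ∑[ y < N ] (χ b y * χ W y + count (y ∈?_) L * χ W y)
      ≡⟨ ∑-distrib-+ (λ y → χ b y * χ W y) _ ⟩
    ∑[ y < N ] (χ b y * χ W y) + ∑[ y < N ] (count (y ∈?_) L * χ W y)
      ≡⟨ cong₂ _+_ (trans (sym (∣∩∣≡∑χχ b W)) ∣b∩W∣≡k) (∑-count L ∣L∩W∣≡k) ⟩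
    k + length L * k
      ∎

  replication-transversal : ∀ x {W : Subset N} {k} L → All (λ b → ∣ b ∩ W ∣ ≡ k) L →
                            (∀ {y} → y ∈ W → pairCount x y L ≡ 1) → count (x ∈?_) L * k ≡ ∣ W ∣
  replication-transversal x {W} L ∣L∩W∣≡k pairs≡1 = begin
    count (x ∈?_) L * _                  ≡⟨ ∑-pairCount x L ∣L∩W∣≡k ⟨
    ∑[ y < N ] (pairCount x y L * χ W y) ≡⟨ ∑-uniform W _ pairs≡1 ⟩
    1 * ∣ W ∣                            ≡⟨ *-identityˡ ∣ W ∣ ⟩
    ∣ W ∣                                ∎

  replication-inside : ∀ {x} {W : Subset N} {k} L → x ∈ W → All (λ b → ∣ b ∩ W ∣ ≡ k) L →
                       (∀ {y} → y ∈ W → y ≢ x → pairCount x y L ≡ 1) →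
                       count (x ∈?_) L * k + 1 ≡ count (x ∈?_) L + ∣ W ∣
  replication-inside {x} {W} {k} L x∈W ∣L∩W∣≡k pairs≡1 = begin
    count (x ∈?_) L * k + 1                         ≡⟨ cong₂ _+_ (∑-pairCount x L ∣L∩W∣≡k) χWx≡1 ⟨
    ∑[ y < N ] (pairCount x y L * χ W y) + χ W x    ≡⟨ ∑-except _ (χ W) off-x ⟩
    pairCount x x L * χ W x + ∑[ y < N ] χ W y      ≡⟨ cong₂ _+_ (cong₂ _*_ (pairCount-diag x L) χWx≡1) (sym (∣∣≡∑χ W)) ⟩
    count (x ∈?_) L * 1 + ∣ W ∣                     ≡⟨ cong (_+ ∣ W ∣) (*-identityʳ _) ⟩
    count (x ∈?_) L + ∣ W ∣                         ∎
    where
    χWx≡1 : χ W x ≡ 1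
    χWx≡1 = 𝟙[]-yes (x ∈? W) x∈W
    off-x : ∀ y → y ≢ x → pairCount x y L * χ W y ≡ χ W y
    off-x y y≢x with y ∈? W
    ... | yes y∈W = cong (_* 1) (pairs≡1 y∈W y≢x)
    ... | no  _   = *-zeroʳ (pairCount x y L)

  block-count : ∀ {W : Subset N} {k c r} L → All (λ b → ∣ b ∩ W ∣ ≡ k) L →
                (∀ {y} → y ∈ W → count (y ∈?_) L * c ≡ r) → length L * k * c ≡ r * ∣ W ∣
  block-count {W} {k} {c} {r} L ∣L∩W∣≡k replication = begin
    length L * k * c                            ≡⟨ cong (_* c) (∑-count L ∣L∩W∣≡k) ⟨
    ∑[ y < N ] (count (y ∈?_) L * χ W y) * c    ≡⟨ *-distribʳ-sum c (λ y → count (y ∈?_) L * χ W y) ⟩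
    ∑[ y < N ] (count (y ∈?_) L * χ W y * c)    ≡⟨ sum-cong-≗ (λ y → xy∙z≈xz∙y (count (y ∈?_) L) (χ W y) c) ⟩
    ∑[ y < N ] (count (y ∈?_) L * c * χ W y)    ≡⟨ ∑-uniform W (λ y → count (y ∈?_) L * c) replication ⟩
    r * ∣ W ∣                                   ∎

-- Column multiplicities of H_{n,t}

∑ᵥ : ∀ n → (GF2 n → ℕ) → ℕ
∑ᵥ zero    f = f []
∑ᵥ (suc n) f = ∑ᵥ n (f ∘ (false ∷_)) + ∑ᵥ n (f ∘ (true ∷_))

∑ᵥ-cong : ∀ n {f g : GF2 n → ℕ} → (∀ v → f v ≡ g v) → ∑ᵥ n f ≡ ∑ᵥ n g
∑ᵥ-cong zero    f≗g = f≗g []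
∑ᵥ-cong (suc n) f≗g = cong₂ _+_ (∑ᵥ-cong n (f≗g ∘ (false ∷_))) (∑ᵥ-cong n (f≗g ∘ (true ∷_)))

∑ᵥ-distrib-+ : ∀ n (f g : GF2 n → ℕ) → ∑ᵥ n (λ v → f v + g v) ≡ ∑ᵥ n f + ∑ᵥ n g
∑ᵥ-distrib-+ zero    f g = refl
∑ᵥ-distrib-+ (suc n) f g =
  trans (cong₂ _+_ (∑ᵥ-distrib-+ n (f ∘ (false ∷_)) (g ∘ (false ∷_))) (∑ᵥ-distrib-+ n (f ∘ (true ∷_)) (g ∘ (true ∷_))))
        (+-interchange (∑ᵥ n (f ∘ (false ∷_))) (∑ᵥ n (g ∘ (false ∷_))) (∑ᵥ n (f ∘ (true ∷_))) (∑ᵥ n (g ∘ (true ∷_))))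

∑ᵥ-distribˡ-* : ∀ n c (f : GF2 n → ℕ) → ∑ᵥ n (λ v → c * f v) ≡ c * ∑ᵥ n f
∑ᵥ-distribˡ-* zero    c f = refl
∑ᵥ-distribˡ-* (suc n) c f =
  trans (cong₂ _+_ (∑ᵥ-distribˡ-* n c (f ∘ (false ∷_))) (∑ᵥ-distribˡ-* n c (f ∘ (true ∷_))))
        (sym (*-distribˡ-+ c _ _))

∑ᵥ-zero : ∀ n → ∑ᵥ n (λ _ → 0) ≡ 0
∑ᵥ-zero zero    = refl
∑ᵥ-zero (suc n) = cong₂ _+_ (∑ᵥ-zero n) (∑ᵥ-zero n)

∑ᵥ-one : ∀ n → ∑ᵥ n (λ _ → 1) ≡ 2 ^ n
∑ᵥ-one zero    = refl
∑ᵥ-one (suc n) = trans (cong₂ _+_ (∑ᵥ-one n) (∑ᵥ-one n)) (cong (2 ^ n +_) (sym (+-identityʳ (2 ^ n))))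

∑ᵥ-δ : ∀ n (w : GF2 n) (f : GF2 n → ℕ) → ∑ᵥ n (λ v → 𝟙[ v ≟v w ] * f v) ≡ f w
∑ᵥ-δ zero    []          f = +-identityʳ (f [])
∑ᵥ-δ (suc n) (false ∷ w) f =
  trans (cong₂ _+_ (∑ᵥ-δ n w (f ∘ (false ∷_))) (∑ᵥ-zero n)) (+-identityʳ (f (false ∷ w)))
∑ᵥ-δ (suc n) (true  ∷ w) f =
  trans (cong (_+ ∑ᵥ n (λ v → 𝟙[ v ≟v w ] * f (true ∷ v))) (∑ᵥ-zero n)) (∑ᵥ-δ n w (f ∘ (true ∷_)))

∑-∑ᵥ-comm : ∀ {N} n (f : Fin N → GF2 n → ℕ) → ∑[ i < N ] ∑ᵥ n (f i) ≡ ∑ᵥ n (λ v → ∑[ i < N ] f i v)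
∑-∑ᵥ-comm zero    f = refl
∑-∑ᵥ-comm (suc n) f =
  trans (∑-distrib-+ (λ i → ∑ᵥ n (f i ∘ (false ∷_))) (λ i → ∑ᵥ n (f i ∘ (true ∷_))))
        (cong₂ _+_ (∑-∑ᵥ-comm n (λ i → f i ∘ (false ∷_))) (∑-∑ᵥ-comm n (λ i → f i ∘ (true ∷_))))

module _ {N n} (e : Fin N → GF2 n) (e≢0 : ∀ i → Nonzero (e i)) (e-injective : ∀ i j → e i ≡ e j → i ≡ j)
         (e-onto : ∀ v → Nonzero v → ∃ λ i → e i ≡ v) where

  preimages : ∀ v → ∑[ i < N ] 𝟙[ v ≟v e i ] + 𝟙[ v ≟v 0v ] ≡ 1
  preimages v with v ≟v 0v
  ... | yes refl = cong (_+ 1) (trans (sum-cong-≗ (λ i → 𝟙[]-no (0v ≟v e i) (e≢0 i ∘ sym))) (sum-replicate-zero N))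
  ... | no  v≢0  = let i₀ , ei₀≡v = e-onto v v≢0 in
    trans (+-identityʳ _) (trans (sum-cong-≗ (λ i → cong 𝟙 (does-⇔ (v≡ei⇔i≡i₀ ei₀≡v i) (v ≟v e i) (i Finₚ.≟ i₀)))) (∑-δ i₀))
    where
    v≡ei⇔i≡i₀ : ∀ {i₀} → e i₀ ≡ v → ∀ i → v ≡ e i ⇔ i ≡ i₀
    v≡ei⇔i≡i₀ {i₀} ei₀≡v i = mk⇔ (λ v≡ei → e-injective i i₀ (trans (sym v≡ei) (sym ei₀≡v)))
                                 (λ { refl → sym ei₀≡v })

  ∑ᵥ-enumeration : ∀ f → ∑[ i < N ] f (e i) + f 0v ≡ ∑ᵥ n f
  ∑ᵥ-enumeration f = begin
    ∑[ i < N ] f (e i) + f 0v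
      ≡⟨ cong₂ _+_ (sum-cong-≗ (λ i → ∑ᵥ-δ n (e i) f)) (∑ᵥ-δ n 0v f) ⟨
    ∑[ i < N ] ∑ᵥ n (λ v → 𝟙[ v ≟v e i ] * f v) + ∑ᵥ n (λ v → 𝟙[ v ≟v 0v ] * f v)
      ≡⟨ cong (_+ _) (∑-∑ᵥ-comm n (λ i v → 𝟙[ v ≟v e i ] * f v)) ⟩
    ∑ᵥ n (λ v → ∑[ i < N ] (𝟙[ v ≟v e i ] * f v)) + ∑ᵥ n (λ v → 𝟙[ v ≟v 0v ] * f v)
      ≡⟨ ∑ᵥ-distrib-+ n _ _ ⟨
    ∑ᵥ n (λ v → ∑[ i < N ] (𝟙[ v ≟v e i ] * f v) + 𝟙[ v ≟v 0v ] * f v)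
      ≡⟨ ∑ᵥ-cong n (λ v → trans (*-distribʳ-+ (f v) (∑[ i < N ] 𝟙[ v ≟v e i ]) 𝟙[ v ≟v 0v ]) (cong (_+ _) (*-distribʳ-sum (f v) (λ i → 𝟙[ v ≟v e i ])))) ⟨
    ∑ᵥ n (λ v → (∑[ i < N ] 𝟙[ v ≟v e i ] + 𝟙[ v ≟v 0v ]) * f v)
      ≡⟨ ∑ᵥ-cong n (λ v → trans (cong (_* f v) (preimages v)) (*-identityˡ (f v))) ⟩
    ∑ᵥ n f
      ∎

StrictlyIncreasing : ∀ {k n} → (Fin k → Fin n) → Set
StrictlyIncreasing keep = ∀ i j → i Fin.< j → keep i Fin.< keep j

restrict : ∀ {k n} → (Fin k → Fin n) → GF2 n → GF2 k
restrict keep v = tabulate (λ j → lookup v (keep j))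

restrict-0v : ∀ {k n} (keep : Fin k → Fin n) → restrict keep 0v ≡ 0v
restrict-0v keep = trans (tabulate-cong (λ j → trans (lookup-replicate (keep j) false) (sym (lookup-replicate j false))))
                         (tabulate∘lookup 0v)

module _ {k n} (keep : Fin k → Fin (suc n)) (keep≢0 : ∀ j → keep j ≢ Fin.zero) where

  lower : Fin k → Fin n
  lower j = Fin.punchOut (≢-sym (keep≢0 j))

  suc∘lower : ∀ j → Fin.suc (lower j) ≡ keep j
  suc∘lower j = Finₚ.punchIn-punchOut (≢-sym (keep≢0 j))

  lower-increasing : StrictlyIncreasing keep → StrictlyIncreasing lower
  lower-increasing increasing i j i<j =
    s<s⁻¹ (subst₂ Fin._<_ (sym (suc∘lower i)) (sym (suc∘lower j)) (increasing i j i<j))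

  restrict-lower : ∀ b v → restrict keep (b ∷ v) ≡ restrict lower v
  restrict-lower b v = tabulate-cong (λ j → cong (lookup (b ∷ v)) (sym (suc∘lower j)))

tail≢0 : ∀ {k n} {keep : Fin (suc k) → Fin (suc n)} → StrictlyIncreasing keep → ∀ j → keep (Fin.suc j) ≢ Fin.zero
tail≢0 {keep = keep} increasing j keep[1+j]≡0 with increasing Fin.zero (Fin.suc j) (s≤s z≤n)
... | keep0<keep[1+j] rewrite keep[1+j]≡0 = n≮0 keep0<keep[1+j]

fiberCount : ∀ n {k} → (Fin k → Fin n) → GF2 k → ℕ
fiberCount n keep u = ∑ᵥ n (λ v → 𝟙[ restrict keep v ≟v u ])

fiberCount-keep-head : ∀ {n k} (keep : Fin (suc k) → Fin (suc n)) (tail≢0 : ∀ j → keep (Fin.suc j) ≢ Fin.zero) →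
                       keep Fin.zero ≡ Fin.zero → ∀ u₀ u →
                       fiberCount (suc n) keep (u₀ ∷ u) ≡ fiberCount n (lower (keep ∘ Fin.suc) tail≢0) u
fiberCount-keep-head {n} keep tail≢0 keep0≡0 u₀ u =
  trans (cong₂ _+_ (first-bit false) (first-bit true)) (one-bit u₀)
  where
  S : ℕ
  S = fiberCount n (lower (keep ∘ Fin.suc) tail≢0) u
  first-bit : ∀ b → ∑ᵥ n (λ v → 𝟙[ restrict keep (b ∷ v) ≟v (u₀ ∷ u) ]) ≡ 𝟙[ b Bool.≟ u₀ ] * S
  first-bit b = trans (∑ᵥ-cong n λ v → trans (cong (λ w → 𝟙[ w ≟v (u₀ ∷ u) ])
                          (cong₂ _∷_ (cong (lookup (b ∷ v)) keep0≡0) (restrict-lower (keep ∘ Fin.suc) tail≢0 b v)))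
                        (𝟙-∧ (does (b Bool.≟ u₀)) _))
                      (∑ᵥ-distribˡ-* n 𝟙[ b Bool.≟ u₀ ] _)
  one-bit : ∀ u₀ → 𝟙[ false Bool.≟ u₀ ] * S + 𝟙[ true Bool.≟ u₀ ] * S ≡ S
  one-bit false = trans (+-identityʳ _) (+-identityʳ S)
  one-bit true  = +-identityʳ S

fiberCount-drop-head : ∀ {n k} (keep : Fin k → Fin (suc n)) (keep≢0 : ∀ j → keep j ≢ Fin.zero) → ∀ u →
                       fiberCount (suc n) keep u ≡ 2 * fiberCount n (lower keep keep≢0) u
fiberCount-drop-head {n} keep keep≢0 u =
  trans (cong₂ _+_ (first-bit false) (first-bit true)) (cong (S +_) (sym (+-identityʳ S)))
  where
  S : ℕ
  S = fiberCount n (lower keep keep≢0) u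
  first-bit : ∀ b → ∑ᵥ n (λ v → 𝟙[ restrict keep (b ∷ v) ≟v u ]) ≡ S
  first-bit b = ∑ᵥ-cong n λ v → cong (λ w → 𝟙[ w ≟v u ]) (restrict-lower keep keep≢0 b v)

fiberCount*2^k≡2^n : ∀ n {k} (keep : Fin k → Fin n) → StrictlyIncreasing keep → ∀ u →
                     fiberCount n keep u * 2 ^ k ≡ 2 ^ n
fiberCount*2^k≡2^n zero    {zero}  keep increasing []       = refl
fiberCount*2^k≡2^n zero    {suc k} keep increasing _        with () ← keep Fin.zero
fiberCount*2^k≡2^n (suc n) {zero}  keep increasing []       = trans (*-identityʳ _) (∑ᵥ-one (suc n))
fiberCount*2^k≡2^n (suc n) {suc k} keep increasing (u₀ ∷ u) with keep Fin.zero Finₚ.≟ Fin.zero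
... | yes keep0≡0 = begin
  fiberCount (suc n) keep (u₀ ∷ u) * (2 * 2 ^ k)
    ≡⟨ cong (_* (2 * 2 ^ k)) (fiberCount-keep-head keep (tail≢0 increasing) keep0≡0 u₀ u) ⟩
  fiberCount n keep′ u * (2 * 2 ^ k)  ≡⟨ x∙yz≈y∙xz (fiberCount n keep′ u) 2 (2 ^ k) ⟩
  2 * (fiberCount n keep′ u * 2 ^ k)  ≡⟨ cong (2 *_) (fiberCount*2^k≡2^n n keep′ increasing′ u) ⟩
  2 * 2 ^ n                           ∎
  where
  keep′ : Fin k → Fin n
  keep′ = lower (keep ∘ Fin.suc) (tail≢0 increasing)
  increasing′ : StrictlyIncreasing keep′
  increasing′ = lower-increasing (keep ∘ Fin.suc) (tail≢0 increasing)
                  (λ i j → increasing (Fin.suc i) (Fin.suc j) ∘ s≤s)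
... | no keep0≢0 = begin
  fiberCount (suc n) keep (u₀ ∷ u) * 2 ^ suc k
    ≡⟨ cong (_* 2 ^ suc k) (fiberCount-drop-head keep keep≢0 (u₀ ∷ u)) ⟩
  2 * fiberCount n keep′ (u₀ ∷ u) * 2 ^ suc k    ≡⟨ *-assoc 2 (fiberCount n keep′ (u₀ ∷ u)) (2 ^ suc k) ⟩
  2 * (fiberCount n keep′ (u₀ ∷ u) * 2 ^ suc k)  ≡⟨ cong (2 *_) (fiberCount*2^k≡2^n n keep′ increasing′ (u₀ ∷ u)) ⟩
  2 * 2 ^ n                                      ∎
  where
  keep≢0 : ∀ j → keep j ≢ Fin.zero
  keep≢0 Fin.zero    = keep0≢0
  keep≢0 (Fin.suc j) = tail≢0 increasing j
  keep′ : Fin (suc k) → Fin n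
  keep′ = lower keep keep≢0
  increasing′ : StrictlyIncreasing keep′
  increasing′ = lower-increasing keep keep≢0 increasing

module ColumnCounts {n t N} (t≤n : t ≤ n) (e : Fin N → GF2 n) (e≢0 : ∀ i → Nonzero (e i))
  (e-injective : ∀ i j → e i ≡ e j → i ≡ j) (e-onto : ∀ v → Nonzero v → ∃ λ i → e i ≡ v)
  (keep : Fin (n ∸ t) → Fin n) (increasing : StrictlyIncreasing keep) where

  column-multiplicity : ∀ u → ∣ G (Hnt e keep) u ∣ + 𝟙[ 0v ≟v u ] ≡ 2 ^ t
  column-multiplicity u = *-cancelʳ-≡ _ _ (2 ^ (n ∸ t)) {{m^n≢0 2 (n ∸ t)}} (begin
    (∣ G (Hnt e keep) u ∣ + 𝟙[ 0v ≟v u ]) * 2 ^ (n ∸ t)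
      ≡⟨ cong₂ (λ s w → (s + 𝟙[ w ≟v u ]) * 2 ^ (n ∸ t))
               (trans (∣∣≡∑χ (G (Hnt e keep) u)) (sum-cong-≗ (λ i → χG≡𝟙 (Hnt e keep) {u} {i}))) (sym (restrict-0v keep)) ⟩
    (∑[ i < N ] 𝟙[ restrict keep (e i) ≟v u ] + 𝟙[ restrict keep 0v ≟v u ]) * 2 ^ (n ∸ t)
      ≡⟨ cong (_* 2 ^ (n ∸ t)) (∑ᵥ-enumeration e e≢0 e-injective e-onto (λ v → 𝟙[ restrict keep v ≟v u ])) ⟩
    fiberCount n keep u * 2 ^ (n ∸ t)
      ≡⟨ fiberCount*2^k≡2^n n keep increasing u ⟩
    2 ^ n
      ≡⟨ cong (2 ^_) (m+[n∸m]≡n t≤n) ⟨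
    2 ^ (t + (n ∸ t))
      ≡⟨ ^-distribˡ-+-* 2 t (n ∸ t) ⟩
    2 ^ t * 2 ^ (n ∸ t)
      ∎)

  ∣G∣≡2^t : ∀ u → Nonzero u → ∣ G (Hnt e keep) u ∣ ≡ 2 ^ t
  ∣G∣≡2^t u u≢0 = trans (sym (+-identityʳ _))
    (trans (cong (∣ G (Hnt e keep) u ∣ +_) (sym (𝟙[]-no (0v ≟v u) (u≢0 ∘ sym)))) (column-multiplicity u))

  1+∣V₀∣≡2^t : suc ∣ V0 (Hnt e keep) ∣ ≡ 2 ^ t
  1+∣V₀∣≡2^t = trans (+-comm 1 _)
    (trans (cong (∣ V0 (Hnt e keep) ∣ +_) (sym (𝟙[]-yes (0v {n ∸ t} ≟v 0v) refl))) (column-multiplicity 0v))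

-- Steiner triple systems inside 𝒟

module Decomposition
  {N m} (col : Fin N → GF2 m) (t : ℕ) (1≤t : 1 ≤ t)
  (∣G∣≡2^t : ∀ u → Nonzero u → ∣ G col u ∣ ≡ 2 ^ t)
  (1+∣V₀∣≡2^t : suc ∣ V0 col ∣ ≡ 2 ^ t)
  (Bs : List (Subset N)) (sts : IsSTS ⊤ Bs) (dblocks : All (IsDBlock col) Bs)
  where

  open Classes col

  T : ℕ
  T = 2 ^ t ∸ 1

  ∣V₀∣≡T : ∣ V0 col ∣ ≡ T
  ∣V₀∣≡T = cong (_∸ 1) 1+∣V₀∣≡2^t

  T+1≡2^t : T + 1 ≡ 2 ^ t
  T+1≡2^t = trans (cong (_+ 1) (sym ∣V₀∣≡T)) (trans (+-comm _ 1) 1+∣V₀∣≡2^t)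

  pairs≡1 : ∀ {x y} → x ≢ y → pairCount x y Bs ≡ 1
  pairs≡1 x≢y = proj₂ (proj₂ sts) _ _ ∈⊤ ∈⊤ x≢y

  pairCount-filter : ∀ {q} {Q : Subset N → Set q} (Q? : Decidable Q) {x y} → x ≢ y →
                    (∀ {b z} → IsTriple col b x y z → Q b) → pairCount x y (filter Q? Bs) ≡ 1
  pairCount-filter {Q = Q} Q? {x} {y} x≢y triple⇒Q =
    trans (count-filter (λ b → (x ∈? b) ×-dec (y ∈? b)) Q? (All.map through dblocks)) (pairs≡1 x≢y)
    where
    through : ∀ {b} → IsDBlock col b → x ∈ b × y ∈ b → Q b
    through d (x∈b , y∈b) = triple⇒Q (proj₂ (dblock-through d x∈b y∈b x≢y))

  filtered-blocks : ∀ {q} {Q : Subset N → Set q} (Q? : Decidable Q) → All (λ b → IsDBlock col b × Q b) (filter Q? Bs)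
  filtered-blocks Q? = All.tabulate λ b∈ → let b∈Bs , Qb = ∈-filter⁻ Q? {xs = Bs} b∈ in All.lookup dblocks b∈Bs , Qb

  G-distinct : ∀ {v w x y} → v ≢ w → x ∈ G col v → y ∈ G col w → x ≢ y
  G-distinct v≢w x∈Gv y∈Gw refl = v≢w (trans (sym (∈G⁻ col x∈Gv)) (∈G⁻ col y∈Gw))

  module SubsystemOnV₀ where

    B₀-pairs : ∀ {x y} → x ∈ V0 col → y ∈ V0 col → x ≢ y → pairCount x y (B₀ Bs) ≡ 1
    B₀-pairs x∈V₀ y∈V₀ x≢y = pairCount-filter InB0? x≢y (λ t → triple⊆V₀ t (∈G⁻ col x∈V₀) (∈G⁻ col y∈V₀))

    B₀-sts : IsSTS (V0 col) (B₀ Bs)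
    B₀-sts = filter⁺ InB0? (proj₁ sts)
           , All.map (map₁ proj₂) (filtered-blocks InB0?)
           , λ _ _ → B₀-pairs

    B₀-∩V₀ : All (λ b → ∣ b ∩ V0 col ∣ ≡ 3) (B₀ Bs)
    B₀-∩V₀ = All.map ∣∩V₀∣≡3 (filtered-blocks InB0?)
      where
      ∣∩V₀∣≡3 : ∀ {b} → IsDBlock col b × b ⊆ V0 col → ∣ b ∩ V0 col ∣ ≡ 3
      ∣∩V₀∣≡3 ((_ , ∣b∣≡3) , b⊆V₀) = trans (cong ∣_∣ (⊆⇒∩≡ b⊆V₀)) ∣b∣≡3

    B₀-replication : ∀ {x} → x ∈ V0 col → count (x ∈?_) (B₀ Bs) * 2 ≡ T ∸ 1
    B₀-replication {x} x∈V₀ = begin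
      r * 2          ≡⟨ m+n∸n≡m (r * 2) 1 ⟨
      r * 2 + 1 ∸ 1  ≡⟨ cong (_∸ 1) (+-cancelˡ-≡ r _ _ (trans (sym (three r)) replication)) ⟩
      T ∸ 1          ∎
      where
      r : ℕ
      r = count (x ∈?_) (B₀ Bs)
      replication : r * 3 + 1 ≡ r + T
      replication = trans (replication-inside (B₀ Bs) x∈V₀ B₀-∩V₀ (λ y∈V₀ y≢x → B₀-pairs x∈V₀ y∈V₀ (≢-sym y≢x)))
                          (cong (r +_) ∣V₀∣≡T)
      three : ∀ r → r * 3 + 1 ≡ r + (r * 2 + 1)
      three = solve 1 (λ r → r :* con 3 :+ con 1 := r :+ (r :* con 2 :+ con 1)) refl

    B₀-length : length (B₀ Bs) ≡ T * (T ∸ 1) / 6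
    B₀-length = trans (sym (m*n/n≡m (length (B₀ Bs)) 6)) (cong (_/ 6) (begin
      length (B₀ Bs) * 6      ≡⟨ *-assoc (length (B₀ Bs)) 3 2 ⟨
      length (B₀ Bs) * 3 * 2  ≡⟨ block-count (B₀ Bs) B₀-∩V₀ B₀-replication ⟩
      (T ∸ 1) * ∣ V0 col ∣    ≡⟨ cong ((T ∸ 1) *_) ∣V₀∣≡T ⟩
      (T ∸ 1) * T             ≡⟨ *-comm (T ∸ 1) T ⟩
      T * (T ∸ 1)             ∎))

  module OneFactorization (u : GF2 m) (u≢0 : Nonzero u) where

    ∣Gu∣≡2^t : ∣ G col u ∣ ≡ 2 ^ t
    ∣Gu∣≡2^t = ∣G∣≡2^t u u≢0

    V₀-G-distinct : ∀ {x y} → x ∈ V0 col → y ∈ G col u → x ≢ y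
    V₀-G-distinct = G-distinct (u≢0 ∘ sym)

    third∈V₀ : ∀ {b y y′ z} → IsTriple col b y y′ z → y ∈ G col u → y′ ∈ G col u → col z ≡ 0v
    third∈V₀ t y∈G y′∈G = trans (IsTriple.col-z t) (trans (cong₂ _⊕_ (∈G⁻ col y∈G) (∈G⁻ col y′∈G)) (⊕-self u))

    edge-typeU : ∀ {b y y′ z} → IsTriple col b y y′ z → y ∈ G col u → y′ ∈ G col u → TypeU u b
    edge-typeU t y∈G y′∈G =
      triple-typeU (IsTriple-swap₁₂ (IsTriple-swap₂₃ t)) u≢0 (third∈V₀ t y∈G y′∈G) (∈G⁻ col y∈G)

    Bᵤ-∩G : All (λ b → ∣ b ∩ G col u ∣ ≡ 2) (Bu u Bs)
    Bᵤ-∩G = All.map (proj₂ ∘ proj₂) (filtered-blocks (TypeU? u))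

    V₀-G-pairs : ∀ {x y} → x ∈ V0 col → y ∈ G col u → pairCount x y (Bu u Bs) ≡ 1
    V₀-G-pairs x∈V₀ y∈G = pairCount-filter (TypeU? u) (V₀-G-distinct x∈V₀ y∈G)
                            (λ t → triple-typeU t u≢0 (∈G⁻ col x∈V₀) (∈G⁻ col y∈G))

    G-pairs : ∀ {y y′} → y ∈ G col u → y′ ∈ G col u → y ≢ y′ → pairCount y y′ (Bu u Bs) ≡ 1
    G-pairs y∈G y′∈G y≢y′ = pairCount-filter (TypeU? u) y≢y′ (λ t → edge-typeU t y∈G y′∈G)

    G-replication : ∀ {y} → y ∈ G col u → count (y ∈?_) (Bu u Bs) ≡ T
    G-replication {y} y∈G =
      +-cancelʳ-≡ 1 r T (trans (+-cancelˡ-≡ r _ _ (trans (sym (double r)) replication)) (sym T+1≡2^t))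
      where
      r : ℕ
      r = count (y ∈?_) (Bu u Bs)
      replication : r * 2 + 1 ≡ r + 2 ^ t
      replication = trans (replication-inside (Bu u Bs) y∈G Bᵤ-∩G (λ y′∈G y′≢y → G-pairs y∈G y′∈G (≢-sym y′≢y)))
                          (cong (r +_) ∣Gu∣≡2^t)
      double : ∀ r → r * 2 + 1 ≡ r + (r + 1)
      double = solve 1 (λ r → r :* con 2 :+ con 1 := r :+ (r :+ con 1)) refl

    Bᵤ-length : length (Bu u Bs) ≡ T * (T + 1) / 2
    Bᵤ-length = trans (sym (m*n/n≡m (length (Bu u Bs)) 2)) (cong (_/ 2) (begin
      length (Bu u Bs) * 2      ≡⟨ *-identityʳ _ ⟨
      length (Bu u Bs) * 2 * 1  ≡⟨ block-count (Bu u Bs) Bᵤ-∩G (λ y∈G → trans (*-identityʳ _) (G-replication y∈G)) ⟩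
      T * ∣ G col u ∣           ≡⟨ cong (T *_) (trans ∣Gu∣≡2^t (sym T+1≡2^t)) ⟩
      T * (T + 1)               ∎))

    V₀-replication : ∀ x → x ∈ V0 col → count (x ∈?_) (Bu u Bs) ≡ 2 ^ (t ∸ 1)
    V₀-replication x x∈V₀ = *-cancelʳ-≡ _ _ 2 (begin
      count (x ∈?_) (Bu u Bs) * 2  ≡⟨ replication-transversal x (Bu u Bs) Bᵤ-∩G (V₀-G-pairs x∈V₀) ⟩
      ∣ G col u ∣                  ≡⟨ ∣Gu∣≡2^t ⟩
      2 ^ t                        ≡⟨ 2^t≡2^[t∸1]*2 1≤t ⟩
      2 ^ (t ∸ 1) * 2              ∎)
      where
      2^t≡2^[t∸1]*2 : ∀ {t} → 1 ≤ t → 2 ^ t ≡ 2 ^ (t ∸ 1) * 2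
      2^t≡2^[t∸1]*2 {suc t} _ = *-comm 2 (2 ^ t)

    edge⊆G : ∀ {b x} → IsDBlock col b → TypeU u b → x ∈ V0 col → x ∈ b → b - x ⊆ G col u
    edge⊆G {b} {x} d (_ , ∣b∩G∣≡2) x∈V₀ x∈b = others⊆G (proj₂ (proj₂ (dblock-from d x∈b)))
      where
      others∈G : ∀ {v w} → IsTriple col b x v w → v ∈ G col u × w ∈ G col u
      others∈G {v} {w} t = χ+χ≡2 (G col u)
        (trans (cong (_+ (χ (G col u) v + χ (G col u) w)) (sym (χG≡0 col x (λ colx≡u → u≢0 (trans (sym colx≡u) (∈G⁻ col x∈V₀))))))
               (trans (sym (triple-∣∩∣ t (G col u))) ∣b∩G∣≡2))
      others⊆G : ∀ {v w} → IsTriple col b x v w → b - x ⊆ G col u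
      others⊆G t i∈b-x with IsTriple.⊆xyz t (x∈p-y⇒x∈p i∈b-x)
      ... | inj₁ i≡x         = ⊥-elim (x∈p-y⇒x≢y i∈b-x i≡x)
      ... | inj₂ (inj₁ refl) = proj₁ (others∈G t)
      ... | inj₂ (inj₂ refl) = proj₂ (others∈G t)

    one-factor : ∀ x → x ∈ V0 col → IsOneFactor (G col u) (Fu u Bs x)
    one-factor x x∈V₀ = All-map⁺ (All.tabulate edge) , λ y y∈G →
      trans (count-remove (Bu u Bs) (≢-sym (V₀-G-distinct x∈V₀ y∈G))) (V₀-G-pairs x∈V₀ y∈G)
      where
      edge : ∀ {b} → b ∈ₗ filter (x ∈?_) (Bu u Bs) → ∣ b - x ∣ ≡ 2 × b - x ⊆ G col u
      edge b∈ =
        let b∈Bᵤ , x∈b   = ∈-filter⁻ (x ∈?_) {xs = Bu u Bs} b∈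
            b∈Bs , typeU = ∈-filter⁻ (TypeU? u) {xs = Bs} b∈Bᵤ
            d            = All.lookup dblocks b∈Bs
        in suc-injective (trans (sym (∣p∣≡1+∣p-x∣ x∈b)) (proj₂ d)) , edge⊆G d typeU x∈V₀ x∈b

    edge-block : ∀ {y y′} → y ∈ G col u → y′ ∈ G col u → y ≢ y′ →
                 ∃₂ λ b z → b ∈ₗ Bu u Bs × IsTriple col b y y′ z
    edge-block {y} {y′} y∈G y′∈G y≢y′ =
      let b , b∈Bs , y∈b , y′∈b = count≡1⇒∃ (λ b → (y ∈? b) ×-dec (y′ ∈? b)) (pairs≡1 y≢y′)
          z , t = dblock-through (All.lookup dblocks b∈Bs) y∈b y′∈b y≢y′
      in b , z , ∈-filter⁺ (TypeU? u) b∈Bs (edge-typeU t y∈G y′∈G) , t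

    edge-owner⇔ : ∀ {e b y y′ z} → IsTriple col b y y′ z → b ∈ₗ Bu u Bs → e ≡ b - z →
                  y ∈ G col u → y′ ∈ G col u → ∀ x → (x ∈ V0 col × e ∈ₗ Fu u Bs x) ⇔ x ≡ z
    edge-owner⇔ {e} {b} {y} {y′} {z} t b∈Bᵤ e≡b-z y∈G y′∈G x = mk⇔ owner≡z z-owns
      where
      open IsTriple t renaming (x∈b to y∈b; y∈b to y′∈b; x≢y to y≢y′; x≢z to y≢z; y≢z to y′≢z)
      z-owns : x ≡ z → x ∈ V0 col × e ∈ₗ Fu u Bs x
      z-owns refl = ∈G⁺ col (third∈V₀ t y∈G y′∈G)
                  , subst (_∈ₗ Fu u Bs z) (sym e≡b-z) (∈-map⁺ (_- z) (∈-filter⁺ (z ∈?_) b∈Bᵤ z∈b))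
      same-block : ∀ {b′ w} → b′ ∈ₗ Bu u Bs → e ≡ b′ - w → b′ ≡ b
      same-block {b′} b′∈Bᵤ e≡b′-w = count≡1⇒unique (λ b → (y ∈? b) ×-dec (y′ ∈? b)) (pairs≡1 y≢y′)
        (proj₁ (∈-filter⁻ (TypeU? u) {xs = Bs} b′∈Bᵤ)) (in-b′ y≢z y∈b , in-b′ y′≢z y′∈b)
        (proj₁ (∈-filter⁻ (TypeU? u) {xs = Bs} b∈Bᵤ)) (y∈b , y′∈b)
        where
        in-b′ : ∀ {i} → i ≢ z → i ∈ b → i ∈ b′
        in-b′ i≢z i∈b = x∈p-y⇒x∈p (subst (_ ∈_) (trans (sym e≡b-z) e≡b′-w) (x∈p∧x≢y⇒x∈p-y i∈b i≢z))
      third-point : x ∈ V0 col → x ∈ b → x ≡ z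
      third-point x∈V₀ x∈b with ⊆xyz x∈b
      ... | inj₁ x≡y         = ⊥-elim (V₀-G-distinct x∈V₀ y∈G x≡y)
      ... | inj₂ (inj₁ x≡y′) = ⊥-elim (V₀-G-distinct x∈V₀ y′∈G x≡y′)
      ... | inj₂ (inj₂ x≡z)  = x≡z
      owner≡z : x ∈ V0 col × e ∈ₗ Fu u Bs x → x ≡ z
      owner≡z (x∈V₀ , e∈F) =
        let b′ , b′∈ , e≡b′-x = ∈-map⁻ (_- x) e∈F
            b′∈Bᵤ , x∈b′ = ∈-filter⁻ (x ∈?_) {xs = Bu u Bs} b′∈
        in third-point x∈V₀ (subst (x ∈_) (same-block b′∈Bᵤ e≡b′-x) x∈b′)

    owners : Subset N → ℕ
    owners e = count (λ x → (x ∈? V0 col) ×-dec DecMembership._∈?_ _≟s_ e (Fu u Bs x)) (allFin N)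

    edge-owners : ∀ {e y y′} → e ⊆ G col u → IsPair e y y′ → owners e ≡ 1
    edge-owners {e} {y} {y′} e⊆G e≡yy′@(y∈e , y′∈e , y≢y′ , _) = owned (edge-block (e⊆G y∈e) (e⊆G y′∈e) y≢y′)
      where
      owned : (∃₂ λ b z → b ∈ₗ Bu u Bs × IsTriple col b y y′ z) → owners e ≡ 1
      owned (b , z , b∈Bᵤ , t) = count-allFin _ z (edge-owner⇔ t b∈Bᵤ (pair≡b-z t e≡yy′) (e⊆G y∈e) (e⊆G y′∈e))

    factorization : ∀ e → ∣ e ∣ ≡ 2 → e ⊆ G col u → owners e ≡ 1
    factorization e ∣e∣≡2 e⊆G = edge-owners e⊆G (proj₂ (proj₂ (∣p∣≡2⇒pair ∣e∣≡2)))

  module TransversalDesign (a c : GF2 m) (a≢0 : Nonzero a) (c≢0 : Nonzero c) (a≢c : a ≢ c) where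

    a+c≢0 : Nonzero (a ⊕ c)
    a+c≢0 = a≢c ∘ ⊕≡0v⇒≡

    a≢a+c : a ≢ a ⊕ c
    a≢a+c a≡a+c = c≢0 (⊕≡ˡ⇒≡0v (sym a≡a+c))

    c≢a+c : c ≢ a ⊕ c
    c≢a+c c≡a+c = a≢0 (⊕≡ʳ⇒≡0v (sym c≡a+c))

    Bₗ-blocks : All (λ b → ∣ b ∣ ≡ 3 × TypeL a c b) (Bℓ a c Bs)
    Bₗ-blocks = All.map (map₁ proj₂) (filtered-blocks (TypeL? a c))

    pairs-a-c : ∀ {x y} → x ∈ G col a → y ∈ G col c → pairCount x y (Bℓ a c Bs) ≡ 1
    pairs-a-c x∈Ga y∈Gc = pairCount-filter (TypeL? a c) (G-distinct a≢c x∈Ga y∈Gc)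
      (λ t → triple-typeL t a≢0 c≢0 a≢c (∈G⁻ col x∈Ga) (∈G⁻ col y∈Gc))

    pairs-a-a+c : ∀ {x y} → x ∈ G col a → y ∈ G col (a ⊕ c) → pairCount x y (Bℓ a c Bs) ≡ 1
    pairs-a-a+c x∈Ga y∈Ga+c = pairCount-filter (TypeL? a c) (G-distinct a≢a+c x∈Ga y∈Ga+c)
      (λ t → triple-typeL (IsTriple-swap₂₃ t) a≢0 c≢0 a≢c (∈G⁻ col x∈Ga)
        (trans (IsTriple.col-z t) (trans (cong₂ _⊕_ (∈G⁻ col x∈Ga) (∈G⁻ col y∈Ga+c)) (⊕-cancelˡ a c))))

    pairs-c-a+c : ∀ {x y} → x ∈ G col c → y ∈ G col (a ⊕ c) → pairCount x y (Bℓ a c Bs) ≡ 1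
    pairs-c-a+c x∈Gc y∈Ga+c = pairCount-filter (TypeL? a c) (G-distinct c≢a+c x∈Gc y∈Ga+c)
      (λ t → triple-typeL (IsTriple-swap₁₂ (IsTriple-swap₂₃ t)) a≢0 c≢0 a≢c
        (trans (IsTriple.col-z t) (trans (cong₂ _⊕_ (∈G⁻ col x∈Gc) (∈G⁻ col y∈Ga+c)) (⊕-cancelʳ c a))) (∈G⁻ col x∈Gc))

    Ga-replication : ∀ {x} → x ∈ G col a → count (x ∈?_) (Bℓ a c Bs) * 1 ≡ 2 ^ t
    Ga-replication {x} x∈Ga =
      trans (replication-transversal x (Bℓ a c Bs) (All.map (proj₁ ∘ proj₂ ∘ proj₂) Bₗ-blocks) (pairs-a-c x∈Ga))
            (∣G∣≡2^t c c≢0)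

    Bₗ-length : length (Bℓ a c Bs) ≡ 2 ^ (2 * t)
    Bₗ-length = begin
      length (Bℓ a c Bs)          ≡⟨ trans (*-identityʳ _) (*-identityʳ _) ⟨
      length (Bℓ a c Bs) * 1 * 1  ≡⟨ block-count (Bℓ a c Bs) (All.map (proj₁ ∘ proj₂) Bₗ-blocks) Ga-replication ⟩
      2 ^ t * ∣ G col a ∣         ≡⟨ cong (2 ^ t *_) (∣G∣≡2^t a a≢0) ⟩
      2 ^ t * 2 ^ t               ≡⟨ ^-distribˡ-+-* 2 t t ⟨
      2 ^ (t + t)                 ≡⟨ cong (λ s → 2 ^ (t + s)) (+-identityʳ t) ⟨
      2 ^ (2 * t)                 ∎

    transversal-design : IsTD3 (T + 1) (G col a) (G col c) (G col (a ⊕ c)) (Bℓ a c Bs)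
    transversal-design =
      ∣G∣≡T+1 a≢0 , ∣G∣≡T+1 c≢0 , ∣G∣≡T+1 a+c≢0 ,
      disjoint a≢c , disjoint a≢a+c , disjoint c≢a+c ,
      filter⁺ (TypeL? a c) (proj₁ sts) ,
      Bₗ-blocks ,
      λ { _ _ (inj₁ (x∈Ga , y∈Gc))          → pairs-a-c x∈Ga y∈Gc
        ; _ _ (inj₂ (inj₁ (x∈Ga , y∈Ga+c))) → pairs-a-a+c x∈Ga y∈Ga+c
        ; _ _ (inj₂ (inj₂ (x∈Gc , y∈Ga+c))) → pairs-c-a+c x∈Gc y∈Ga+c }
      where
      ∣G∣≡T+1 : ∀ {v} → Nonzero v → ∣ G col v ∣ ≡ T + 1
      ∣G∣≡T+1 v≢0 = trans (∣G∣≡2^t _ v≢0) (sym T+1≡2^t)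
      disjoint : ∀ {v w} → v ≢ w → ∀ x → x ∈ G col v → x ∉ G col w
      disjoint v≢w x x∈Gv x∈Gw = G-distinct v≢w x∈Gv x∈Gw refl

  conclusion : Conclusion t Bs
  conclusion =
    All.map classify dblocks ,
    (SubsystemOnV₀.B₀-length , SubsystemOnV₀.B₀-sts) ,
    (λ u u≢0 → let open OneFactorization u u≢0 in Bᵤ-length , V₀-replication , one-factor , factorization) ,
    (λ a c a≢0 c≢0 a≢c → let open TransversalDesign a c a≢0 c≢0 a≢c in Bₗ-length , transversal-design)


theorem2p8 : (n t : ℕ) → 2 ≤ n → 1 ≤ t → t ≤ n ∸ 1 →
    (e : Fin (2 ^ n ∸ 1) → Vec Bool n) →
    (∀ i → Nonzero (e i)) →
    (∀ i j → e i ≡ e j → i ≡ j) →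
    (∀ v → Nonzero v → ∃ (λ i → e i ≡ v)) →
    (keep : Fin (n ∸ t) → Fin n) →
    (∀ i j → i Fin.< j → keep i Fin.< keep j) →
    (Bs : List (Subset (2 ^ n ∸ 1))) →
    IsSTS ⊤ Bs →
    All (IsDBlock (Hnt e keep)) Bs →
    Classes.Conclusion (Hnt e keep) t Bs
theorem2p8 n t _ 1≤t t≤n∸1 e e≢0 e-injective e-onto keep increasing Bs sts dblocks =
  Decomposition.conclusion (Hnt e keep) t 1≤t ∣G∣≡2^t 1+∣V₀∣≡2^t Bs sts dblocks
  where
  open ColumnCounts (≤-trans t≤n∸1 (m∸n≤m n 1)) e e≢0 e-injective e-onto keep increasing
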